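{- For every integer $n\ge 0$, $$s_n=\sum_{k=0}^{n}(-1)^{n-k}s_{n,k}\,m_k,\qquad\text{where } s_{n,k}=\sum_{j=0}^{n-k}\binom{k+j}{k}\binom{j}{n-j-k}.$$ Moreover, for each $k\ge 0$, $\sum_{n\ge 0}s_{n,k}x^n=x^k\left(\frac{1}{1-x-x^2}\right)^{k+1}$. Here $s_n$ is the number of symmetric Schröder paths of length $2n$ and $m_n$ is the number of symmetric Motzkin paths of length $2n$.
   Context: Steps: up step $U=(1,1)$, down step $D=(1,-1)$, horizontal step $h=(1,0)$, 2-horizontal step $H=(2,0)$. A Motzkin path of length $2n$ is a lattice path from $(0,0)$ to $(2n,0)$ using steps $U,D,h$ that never goes below the $x$-axis; a Schröder path of length $2n$ is the same with steps $U,D,H$. A path of length $2n$ is symmetric if it passes through a lattice point with $x$-coordinate $n$ and its part on $[n,2n]$ is the mirror image of its part on $[0,n]$ under the reflection $x\mapsto 2n-x$. $m_n$ ($1,2,5,13,35,\dots$) and $s_n$ ($1,1,3,5,13,\dots$) count symmetric Motzkin and symmetric Schröder paths of length $2n$ respectively. Binomial coefficients $\binom{a}{b}$ with $b<0$ or $b>a$ are $0$. -}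

module Defs where

open import Data.Nat using (ℕ; zero; suc; _+_; _∸_; _≡ᵇ_; _≤ᵇ_)
import Data.Nat as ℕ
open import Data.Nat.Combinatorics using (_C_)
open import Data.Bool using (Bool; true; false; _∧_; _∨_; if_then_else_)
open import Data.List using (List; []; _∷_; _++_; reverse; map; length; take; drop; filter; concatMap; upTo)
open import Data.Integer using (ℤ; +_; -_; _*_)
import Data.Integer as ℤ
open import Relation.Nullary.Decidable using (does)
open import Relation.Unary using (Decidable)
open import Relation.Binary.PropositionalEquality using (_≡_)

-- Steps: U = (1,1), D = (1,-1), h = (1,0), H = (2,0)

data Step : Set where
  U D h H : Step

width : Step → ℕ
width H = 2
width _ = 1

pathWidth : List Step → ℕ
pathWidth [] = 0
pathWidth (s ∷ p) = width s + pathWidth p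

nonNegEndsZero : ℕ → List Step → Bool
nonNegEndsZero zero [] = true
nonNegEndsZero (suc _) [] = false
nonNegEndsZero ht (U ∷ p) = nonNegEndsZero (suc ht) p
nonNegEndsZero zero (D ∷ p) = false
nonNegEndsZero (suc ht) (D ∷ p) = nonNegEndsZero ht p
nonNegEndsZero ht (h ∷ p) = nonNegEndsZero ht p
nonNegEndsZero ht (H ∷ p) = nonNegEndsZero ht p

motzkinStep : Step → Bool
motzkinStep H = false
motzkinStep _ = true

schroderStep : Step → Bool
schroderStep h = false
schroderStep _ = true

allB : (Step → Bool) → List Step → Bool
allB P [] = true
allB P (s ∷ p) = P s ∧ allB P p

stepEq : Step → Step → Bool
stepEq U U = true
stepEq D D = true
stepEq h h = true
stepEq H H = true
stepEq _ _ = false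

pathEq : List Step → List Step → Bool
pathEq [] [] = true
pathEq (s ∷ p) (t ∷ q) = stepEq s t ∧ pathEq p q
pathEq _ _ = false

isMotzkin : ℕ → List Step → Bool
isMotzkin n p = allB motzkinStep p ∧ (pathWidth p ≡ᵇ (n + n)) ∧ nonNegEndsZero 0 p

isSchroder : ℕ → List Step → Bool
isSchroder n p = allB schroderStep p ∧ (pathWidth p ≡ᵇ (n + n)) ∧ nonNegEndsZero 0 p

mirrorStep : Step → Step
mirrorStep U = D
mirrorStep D = U
mirrorStep s = s

mirror : List Step → List Step
mirror p = reverse (map mirrorStep p)

isSymmetric : ℕ → List Step → Bool
isSymmetric n p = go (upTo (suc (length p)))
  where
  go : List ℕ → Bool
  go [] = false
  go (i ∷ is) = ((pathWidth (take i p) ≡ᵇ n) ∧ pathEq (drop i p) (mirror (take i p))) ∨ go is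

listsOfLength : ℕ → List (List Step)
listsOfLength zero = [] ∷ []
listsOfLength (suc k) = concatMap (λ p → map (_∷ p) (U ∷ D ∷ h ∷ H ∷ [])) (listsOfLength k)

-- all lists of steps with at most k steps (every path of length 2n has ≤ 2n steps)
listsUpTo : ℕ → List (List Step)
listsUpTo k = concatMap listsOfLength (upTo (suc k))

countB : (List Step → Bool) → List (List Step) → ℕ
countB P [] = 0
countB P (p ∷ ps) = (if P p then 1 else 0) + countB P ps

m : ℕ → ℕ
m n = countB (λ p → isMotzkin n p ∧ isSymmetric n p) (listsUpTo (n + n))

s : ℕ → ℕ
s n = countB (λ p → isSchroder n p ∧ isSymmetric n p) (listsUpTo (n + n))

ΣZ : ℕ → (ℕ → ℤ) → ℤ
ΣZ zero f = f 0
ΣZ (suc n) f = ΣZ n f ℤ.+ f (suc n)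

ΣN : ℕ → (ℕ → ℕ) → ℕ
ΣN zero f = f 0
ΣN (suc n) f = ΣN n f + f (suc n)

sign : ℕ → ℤ
sign zero = + 1
sign (suc e) = - sign e

-- s_{n,k} = Σ_{j=0}^{n-k} C(k+j,k) C(j, n-j-k)
-- For n < k the range j = 0..n-k is empty, so s_{n,k} = 0.
snk : ℕ → ℕ → ℕ
snk n k = if k ≤ᵇ n then ΣN (n ∸ k) (λ j → ((k + j) C k) ℕ.* (j C (n ∸ j ∸ k))) else 0

-- formal power series over ℤ as coefficient sequences

Series : Set
Series = ℕ → ℤ

_⊛_ : Series → Series → Series
(f ⊛ g) n = ΣZ n (λ i → f i * g (n ∸ i))

oneS : Series
oneS zero = + 1
oneS (suc _) = + 0

_^S_ : Series → ℕ → Series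
f ^S zero = oneS
f ^S suc k = f ⊛ (f ^S k)

xPow : ℕ → Series
xPow k n = if n ≡ᵇ k then + 1 else + 0

oneMinusXMinusX² : Series
oneMinusXMinusX² 0 = + 1
oneMinusXMinusX² 1 = - (+ 1)
oneMinusXMinusX² 2 = - (+ 1)
oneMinusXMinusX² _ = + 0

snkGF : ℕ → Series
snkGF k n = + snk n k

-- A symmetric path of length 2n is determined by its left half, a meander of width n: a path
-- from height 0 that never goes below the axis and ends at any height. Sorting meanders that
-- start at height x by their first step, the Motzkin counts F_k and the Schröder counts G_n,
-- as functions of x, satisfy F_{k+1} = (A + 1) F_k and G_{n+2} = A G_{n+1} + G_n, with
-- G_0 = F_0 = 1 and G_1 = A 1, where (A f)(x) = f(x + 1) + f(x − 1) is the adjacency operator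
-- of the half-line. So G_n = Fib_n(A) 1 for the Fibonacci polynomials Fib_n and
-- F_k = (1 + A)^k 1, and the first identity is the expansion of Fib_n(T − 1) in powers of T.
-- Its coefficients (−1)^{n−k} s_{n,k} obey c_{n+2}(T) = (T − 1) c_{n+1}(T) + c_n(T), the signed
-- form of s_{n+2,k} = s_{n+1,k−1} + s_{n+1,k} + s_{n,k}. This recurrence follows from
-- s_{n,k} = [x^{n−k}] (1 − x − x²)^{−(k+1)} by Pascal's rule, and it is also exactly what the
-- generating function identity amounts to.

module Submission where

import Algebra.Properties.CommutativeSemigroup as CommutativeSemigroupProperties
open import Data.Bool using (Bool; true; false; T; _∧_; _∨_; if_then_else_)
open import Data.Bool.ListAction using (any)
open import Data.Bool.Properties using (T-∧; T-≡; ∧-assoc; ∧-comm; ∧-identityʳ; ∧-zeroʳ; ∧-idem)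
open import Data.Integer as ℤ using (ℤ; +_; -_; _*_; _+_; _-_)
import Data.Integer.Properties as ℤ
import Data.Integer.Tactic.RingSolver as ℤ-Solver
open import Data.List using (List; []; _∷_; _++_; map; take; drop; length; upTo; applyUpTo; concatMap)
open import Data.List.Membership.Propositional using (_∈_)
open import Data.List.Membership.Propositional.Properties using (∈-upTo⁺; ∈-upTo⁻)
open import Data.List.Properties
  using (length-reverse; length-map; length-take; length-drop; length-++; unfold-reverse; ++-assoc; ++-identityʳ; map-++; map-cong)
open import Data.List.Relation.Unary.Any as Any using (here; there)
open import Data.List.Relation.Unary.Any.Properties using (any⁺)
open import Data.Nat as ℕ using (ℕ; zero; suc; _∸_; _≤_; _<_; z≤n; s≤s; _≡ᵇ_)
open import Data.Nat.Combinatorics using (_C_; nCn≡1; nCk+nC[k+1]≡[n+1]C[k+1])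
open import Data.Nat.ListAction using (sum)
open import Data.Nat.ListAction.Properties using (sum-++)
import Data.Nat.Properties as ℕ
import Data.Nat.Tactic.RingSolver as ℕ-Solver
open import Data.Product using (_×_; _,_)
open import Data.Sum using (inj₁; inj₂)
open import Data.Unit using (tt)
open import Function using (_∘_)
open import Function.Bundles using (Equivalence)
open import Relation.Binary.PropositionalEquality
open import Relation.Nullary using (¬_; yes; no; contradiction)
open import Relation.Nullary.Decidable using (dec-true; dec-false)
open ≡-Reasoning

open import Defs

module ℕ+ = CommutativeSemigroupProperties ℕ.+-commutativeSemigroup
module ℤ+ = CommutativeSemigroupProperties ℤ.+-commutativeSemigroup

ΣN-cong : ∀ n {f g : ℕ → ℕ} → (∀ i → i ≤ n → f i ≡ g i) → ΣN n f ≡ ΣN n g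
ΣN-cong zero    f≡g = f≡g 0 z≤n
ΣN-cong (suc n) f≡g = cong₂ ℕ._+_ (ΣN-cong n (λ i i≤n → f≡g i (ℕ.m≤n⇒m≤1+n i≤n))) (f≡g (suc n) ℕ.≤-refl)

ΣN-unfoldˡ : ∀ n (f : ℕ → ℕ) → ΣN (suc n) f ≡ f 0 ℕ.+ ΣN n (f ∘ suc)
ΣN-unfoldˡ zero    f = refl
ΣN-unfoldˡ (suc n) f = trans (cong (ℕ._+ f (suc (suc n))) (ΣN-unfoldˡ n f)) (ℕ.+-assoc (f 0) _ _)

ΣN-+ : ∀ n (f g : ℕ → ℕ) → ΣN n (λ i → f i ℕ.+ g i) ≡ ΣN n f ℕ.+ ΣN n g
ΣN-+ zero    f g = refl
ΣN-+ (suc n) f g = trans (cong (ℕ._+ (f (suc n) ℕ.+ g (suc n))) (ΣN-+ n f g))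
                         (ℕ+.interchange (ΣN n f) (ΣN n g) (f (suc n)) (g (suc n)))

ΣN-*ˡ : ∀ n a (f : ℕ → ℕ) → ΣN n (λ i → a ℕ.* f i) ≡ a ℕ.* ΣN n f
ΣN-*ˡ zero    a f = refl
ΣN-*ˡ (suc n) a f = trans (cong (ℕ._+ a ℕ.* f (suc n)) (ΣN-*ˡ n a f)) (sym (ℕ.*-distribˡ-+ a (ΣN n f) (f (suc n))))

ΣN-zero : ∀ n → ΣN n (λ _ → 0) ≡ 0
ΣN-zero zero    = refl
ΣN-zero (suc n) = cong (ℕ._+ 0) (ΣN-zero n)

ΣN-double : ∀ n (f : ℕ → ℕ) → (∀ i → f (suc (i ℕ.+ i)) ≡ 0) → ΣN (n ℕ.+ n) f ≡ ΣN n (λ i → f (i ℕ.+ i))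
ΣN-double zero    f odd≡0 = refl
ΣN-double (suc n) f odd≡0 = begin
  ΣN (suc n ℕ.+ suc n) f
    ≡⟨ cong (λ m → ΣN (suc m) f) (ℕ.+-suc n n) ⟩
  ΣN (n ℕ.+ n) f ℕ.+ f (suc (n ℕ.+ n)) ℕ.+ f (suc (suc (n ℕ.+ n)))
    ≡⟨ cong₂ (λ a b → a ℕ.+ b ℕ.+ f (suc (suc (n ℕ.+ n)))) (ΣN-double n f odd≡0) (odd≡0 n) ⟩
  ΣN n (λ i → f (i ℕ.+ i)) ℕ.+ 0 ℕ.+ f (suc (suc (n ℕ.+ n)))
    ≡⟨ cong₂ ℕ._+_ (ℕ.+-identityʳ _) (cong (λ m → f (suc m)) (sym (ℕ.+-suc n n))) ⟩
  ΣN (suc n) (λ i → f (i ℕ.+ i)) ∎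

atPred : (ℕ → ℕ) → ℕ → ℕ
atPred f zero    = 0
atPred f (suc n) = f n

ΣZ-cong : ∀ n {f g : ℕ → ℤ} → (∀ i → i ≤ n → f i ≡ g i) → ΣZ n f ≡ ΣZ n g
ΣZ-cong zero    f≡g = f≡g 0 z≤n
ΣZ-cong (suc n) f≡g = cong₂ _+_ (ΣZ-cong n (λ i i≤n → f≡g i (ℕ.m≤n⇒m≤1+n i≤n))) (f≡g (suc n) ℕ.≤-refl)

ΣZ-unfoldˡ : ∀ n (f : ℕ → ℤ) → ΣZ (suc n) f ≡ f 0 + ΣZ n (f ∘ suc)
ΣZ-unfoldˡ zero    f = refl
ΣZ-unfoldˡ (suc n) f = trans (cong (_+ f (suc (suc n))) (ΣZ-unfoldˡ n f)) (ℤ.+-assoc (f 0) _ _)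

ΣZ-+ : ∀ n (f g : ℕ → ℤ) → ΣZ n (λ i → f i + g i) ≡ ΣZ n f + ΣZ n g
ΣZ-+ zero    f g = refl
ΣZ-+ (suc n) f g = trans (cong (_+ (f (suc n) + g (suc n))) (ΣZ-+ n f g))
                         (ℤ+.interchange (ΣZ n f) (ΣZ n g) (f (suc n)) (g (suc n)))

ΣZ-*ˡ : ∀ n a (f : ℕ → ℤ) → ΣZ n (λ i → a * f i) ≡ a * ΣZ n f
ΣZ-*ˡ zero    a f = refl
ΣZ-*ˡ (suc n) a f = trans (cong (_+ a * f (suc n)) (ΣZ-*ˡ n a f)) (sym (ℤ.*-distribˡ-+ a (ΣZ n f) (f (suc n))))

ΣZ-*ʳ : ∀ n a (f : ℕ → ℤ) → ΣZ n (λ i → f i * a) ≡ ΣZ n f * a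
ΣZ-*ʳ n a f = begin
  ΣZ n (λ i → f i * a) ≡⟨ ΣZ-cong n (λ i _ → ℤ.*-comm (f i) a) ⟩
  ΣZ n (λ i → a * f i) ≡⟨ ΣZ-*ˡ n a f ⟩
  a * ΣZ n f           ≡⟨ ℤ.*-comm a (ΣZ n f) ⟩
  ΣZ n f * a           ∎

ΣZ-- : ∀ n (f g : ℕ → ℤ) → ΣZ n (λ i → f i - g i) ≡ ΣZ n f - ΣZ n g
ΣZ-- n f g = begin
  ΣZ n (λ i → f i - g i)    ≡⟨ ΣZ-+ n f (λ i → - g i) ⟩
  ΣZ n f + ΣZ n (-_ ∘ g)    ≡⟨ cong (_+_ (ΣZ n f)) (ΣZ-neg n) ⟩
  ΣZ n f - ΣZ n g           ∎
  where
  ΣZ-neg : ∀ n → ΣZ n (-_ ∘ g) ≡ - ΣZ n g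
  ΣZ-neg zero    = refl
  ΣZ-neg (suc n) = trans (cong (_- g (suc n)) (ΣZ-neg n)) (sym (ℤ.neg-distrib-+ (ΣZ n g) (g (suc n))))

ΣZ-combine : ∀ n (a b d p : ℕ → ℤ) →
  ΣZ n (λ k → a k * p k) - ΣZ n (λ k → b k * p k) + ΣZ n (λ k → d k * p k) ≡ ΣZ n (λ k → (a k - b k + d k) * p k)
ΣZ-combine n a b d p = begin
  ΣZ n (λ k → a k * p k) - ΣZ n (λ k → b k * p k) + ΣZ n (λ k → d k * p k)
    ≡⟨ cong (_+ ΣZ n (λ k → d k * p k)) (ΣZ-- n _ _) ⟨
  ΣZ n (λ k → a k * p k - b k * p k) + ΣZ n (λ k → d k * p k)
    ≡⟨ ΣZ-+ n _ _ ⟨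
  ΣZ n (λ k → a k * p k - b k * p k + d k * p k)
    ≡⟨ ΣZ-cong n (λ k _ → factor (a k) (b k) (d k) (p k)) ⟩
  ΣZ n (λ k → (a k - b k + d k) * p k) ∎
  where
  factor : ∀ a b d p → a * p - b * p + d * p ≡ (a - b + d) * p
  factor = ℤ-Solver.solve-∀

ΣZ-head : ∀ n (f : ℕ → ℤ) → (∀ i → f (suc i) ≡ + 0) → ΣZ n f ≡ f 0
ΣZ-head zero    f tail≡0 = refl
ΣZ-head (suc n) f tail≡0 = trans (cong₂ _+_ (ΣZ-head n f tail≡0) (tail≡0 n)) (ℤ.+-identityʳ (f 0))

ΣZ-dropLast : ∀ n (f : ℕ → ℤ) → f (suc n) ≡ + 0 → ΣZ (suc n) f ≡ ΣZ n f
ΣZ-dropLast n f last≡0 = trans (cong (_+_ (ΣZ n f)) last≡0) (ℤ.+-identityʳ (ΣZ n f))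

ΣZ-reverse : ∀ n (f : ℕ → ℤ) → ΣZ n f ≡ ΣZ n (λ i → f (n ∸ i))
ΣZ-reverse zero    f = refl
ΣZ-reverse (suc n) f = begin
  ΣZ n f + f (suc n)                    ≡⟨ ℤ.+-comm (ΣZ n f) (f (suc n)) ⟩
  f (suc n) + ΣZ n f                    ≡⟨ cong (_+_ (f (suc n))) (ΣZ-reverse n f) ⟩
  f (suc n) + ΣZ n (λ i → f (n ∸ i))    ≡⟨ ΣZ-unfoldˡ n (λ i → f (suc n ∸ i)) ⟨
  ΣZ (suc n) (λ i → f (suc n ∸ i))      ∎

ΣZ-triangle : ∀ n (F : ℕ → ℕ → ℤ) → ΣZ n (λ i → ΣZ (n ∸ i) (F i)) ≡ ΣZ n (λ p → ΣZ p (λ i → F i (p ∸ i)))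
ΣZ-triangle zero    F = refl
ΣZ-triangle (suc n) F = begin
  ΣZ n (λ i → ΣZ (suc n ∸ i) (F i)) + ΣZ (n ∸ n) (F (suc n))
    ≡⟨ cong₂ _+_ (ΣZ-cong n (λ i i≤n → cong (λ q → ΣZ q (F i)) (ℕ.+-∸-assoc 1 i≤n)))
                 (cong (λ q → ΣZ q (F (suc n))) (ℕ.n∸n≡0 n)) ⟩
  ΣZ n (λ i → ΣZ (n ∸ i) (F i) + F i (suc (n ∸ i))) + F (suc n) 0
    ≡⟨ cong (_+ F (suc n) 0) (ΣZ-+ n _ _) ⟩
  ΣZ n (λ i → ΣZ (n ∸ i) (F i)) + ΣZ n (λ i → F i (suc (n ∸ i))) + F (suc n) 0
    ≡⟨ ℤ.+-assoc (ΣZ n (λ i → ΣZ (n ∸ i) (F i))) _ _ ⟩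
  ΣZ n (λ i → ΣZ (n ∸ i) (F i)) + (ΣZ n (λ i → F i (suc (n ∸ i))) + F (suc n) 0)
    ≡⟨ cong₂ _+_ (ΣZ-triangle n F)
                 (cong₂ _+_ (ΣZ-cong n (λ i i≤n → cong (F i) (sym (ℕ.+-∸-assoc 1 i≤n))))
                            (cong (F (suc n)) (sym (ℕ.n∸n≡0 n)))) ⟩
  ΣZ n (λ p → ΣZ p (λ i → F i (p ∸ i))) + ΣZ (suc n) (λ i → F i (suc n ∸ i)) ∎

xTimes : Series → Series
xTimes f zero    = + 0
xTimes f (suc n) = f n

ΣZ-xTimes : ∀ n g (f : ℕ → ℤ) → ΣZ (suc n) (λ k → xTimes g k * f k) ≡ ΣZ n (λ k → g k * f (suc k))
ΣZ-xTimes n g f = trans (ΣZ-unfoldˡ n (λ k → xTimes g k * f k)) (ℤ.+-identityˡ _)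

pos-+₃ : ∀ a b c → + (a ℕ.+ b ℕ.+ c) ≡ + a + + b + + c
pos-+₃ a b c = trans (ℤ.pos-+ (a ℕ.+ b) c) (cong (_+ + c) (ℤ.pos-+ a b))

-- The coefficient of x^N in W(x + x²), where W(y) = Σ w_j y^j, since (x + x²)^j = x^j (1 + x)^j.
composeXPlusX² : (ℕ → ℕ) → ℕ → ℕ
composeXPlusX² w N = ΣN N (λ j → w j ℕ.* (j C (N ∸ j)))

composeXPlusX²-pascal : ∀ v N → ΣN N (λ j → v j ℕ.* (suc j C (N ∸ j))) ≡ composeXPlusX² v N ℕ.+ atPred (composeXPlusX² v) N
composeXPlusX²-pascal v zero    = sym (ℕ.+-identityʳ _)
composeXPlusX²-pascal v (suc N) = begin
  ΣN N (λ j → v j ℕ.* (suc j C (suc N ∸ j))) ℕ.+ v (suc N) ℕ.* (suc (suc N) C (N ∸ N))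
    ≡⟨ cong₂ ℕ._+_ (trans (ΣN-cong N pascal-term) (ΣN-+ N _ _)) (last-weight (suc (suc N))) ⟩
  composeXPlusX² v N ℕ.+ rest ℕ.+ v (suc N) ℕ.* 1
    ≡⟨ ℕ.+-assoc (composeXPlusX² v N) rest _ ⟩
  composeXPlusX² v N ℕ.+ (rest ℕ.+ v (suc N) ℕ.* 1)
    ≡⟨ ℕ.+-comm (composeXPlusX² v N) _ ⟩
  rest ℕ.+ v (suc N) ℕ.* 1 ℕ.+ composeXPlusX² v N
    ≡⟨ cong (λ t → rest ℕ.+ t ℕ.+ composeXPlusX² v N) (last-weight (suc N)) ⟨
  composeXPlusX² v (suc N) ℕ.+ atPred (composeXPlusX² v) (suc N) ∎
  where
  rest = ΣN N (λ j → v j ℕ.* (j C (suc N ∸ j)))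
  last-weight : ∀ a → v (suc N) ℕ.* (a C (N ∸ N)) ≡ v (suc N) ℕ.* 1
  last-weight a = cong (λ r → v (suc N) ℕ.* (a C r)) (ℕ.n∸n≡0 N)
  pascal-term : ∀ j → j ≤ N → v j ℕ.* (suc j C (suc N ∸ j)) ≡ v j ℕ.* (j C (N ∸ j)) ℕ.+ v j ℕ.* (j C (suc N ∸ j))
  pascal-term j j≤N = begin
    v j ℕ.* (suc j C (suc N ∸ j))                         ≡⟨ cong (λ r → v j ℕ.* (suc j C r)) (ℕ.+-∸-assoc 1 j≤N) ⟩
    v j ℕ.* (suc j C suc (N ∸ j))                         ≡⟨ cong (v j ℕ.*_) (sym (nCk+nC[k+1]≡[n+1]C[k+1] j (N ∸ j))) ⟩
    v j ℕ.* (j C (N ∸ j) ℕ.+ j C suc (N ∸ j))             ≡⟨ ℕ.*-distribˡ-+ (v j) _ _ ⟩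
    v j ℕ.* (j C (N ∸ j)) ℕ.+ v j ℕ.* (j C suc (N ∸ j))
      ≡⟨ cong (λ r → v j ℕ.* (j C (N ∸ j)) ℕ.+ v j ℕ.* (j C r)) (sym (ℕ.+-∸-assoc 1 j≤N)) ⟩
    v j ℕ.* (j C (N ∸ j)) ℕ.+ v j ℕ.* (j C (suc N ∸ j))   ∎

composeXPlusX²-suc : ∀ w N → composeXPlusX² w (suc N) ≡ composeXPlusX² (w ∘ suc) N ℕ.+ atPred (composeXPlusX² (w ∘ suc)) N
composeXPlusX²-suc w N = begin
  composeXPlusX² w (suc N)                       ≡⟨ ΣN-unfoldˡ N _ ⟩
  w 0 ℕ.* 0 ℕ.+ ΣN N (λ j → w (suc j) ℕ.* (suc j C (N ∸ j)))
    ≡⟨ cong (ℕ._+ ΣN N (λ j → w (suc j) ℕ.* (suc j C (N ∸ j)))) (ℕ.*-zeroʳ (w 0)) ⟩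
  ΣN N (λ j → w (suc j) ℕ.* (suc j C (N ∸ j)))   ≡⟨ composeXPlusX²-pascal (w ∘ suc) N ⟩
  composeXPlusX² (w ∘ suc) N ℕ.+ atPred (composeXPlusX² (w ∘ suc)) N ∎

composeXPlusX²-cong : ∀ {w w′} → w ≗ w′ → ∀ N → composeXPlusX² w N ≡ composeXPlusX² w′ N
composeXPlusX²-cong w≗w′ N = ΣN-cong N (λ j _ → cong (ℕ._* (j C (N ∸ j))) (w≗w′ j))

negBinom : ℕ → ℕ → ℕ
negBinom k j = (k ℕ.+ j) C k

-- [x^N] (1 − x − x²)^{−(k+1)}, as negBinom k j = [y^j] (1 − y)^{−(k+1)}.
snkDiag : ℕ → ℕ → ℕ
snkDiag k N = composeXPlusX² (negBinom k) N

snkDiag-zero : ∀ k → snkDiag k 0 ≡ 1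
snkDiag-zero k = begin
  ((k ℕ.+ 0) C k) ℕ.* 1 ≡⟨ ℕ.*-identityʳ _ ⟩
  (k ℕ.+ 0) C k       ≡⟨ cong (_C k) (ℕ.+-identityʳ k) ⟩
  k C k               ≡⟨ nCn≡1 k ⟩
  1                   ∎

snkDiag-suc₀ : ∀ M → snkDiag 0 (suc M) ≡ snkDiag 0 M ℕ.+ atPred (snkDiag 0) M
snkDiag-suc₀ = composeXPlusX²-suc (negBinom 0)

snkDiag-suc : ∀ k M → snkDiag (suc k) (suc M) ≡ snkDiag k (suc M) ℕ.+ snkDiag (suc k) M ℕ.+ atPred (snkDiag (suc k)) M
snkDiag-suc k M = begin
  snkDiag (suc k) (suc M)
    ≡⟨ composeXPlusX²-cong pascal (suc M) ⟩
  ΣN (suc M) (λ j → (negBinom k j ℕ.+ u j) ℕ.* (j C (suc M ∸ j)))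
    ≡⟨ ΣN-cong (suc M) (λ j _ → ℕ.*-distribʳ-+ (j C (suc M ∸ j)) (negBinom k j) (u j)) ⟩
  ΣN (suc M) (λ j → negBinom k j ℕ.* (j C (suc M ∸ j)) ℕ.+ u j ℕ.* (j C (suc M ∸ j)))
    ≡⟨ ΣN-+ (suc M) _ _ ⟩
  snkDiag k (suc M) ℕ.+ composeXPlusX² u (suc M)
    ≡⟨ cong (snkDiag k (suc M) ℕ.+_) (composeXPlusX²-suc u M) ⟩
  snkDiag k (suc M) ℕ.+ (composeXPlusX² (u ∘ suc) M ℕ.+ atPred (composeXPlusX² (u ∘ suc)) M)
    ≡⟨ cong (snkDiag k (suc M) ℕ.+_) (cong₂ ℕ._+_ (composeXPlusX²-cong u∘suc M) (atPred-cong M)) ⟩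
  snkDiag k (suc M) ℕ.+ (snkDiag (suc k) M ℕ.+ atPred (snkDiag (suc k)) M)
    ≡⟨ ℕ.+-assoc (snkDiag k (suc M)) _ _ ⟨
  snkDiag k (suc M) ℕ.+ snkDiag (suc k) M ℕ.+ atPred (snkDiag (suc k)) M ∎
  where
  u : ℕ → ℕ
  u j = (k ℕ.+ j) C suc k
  pascal : negBinom (suc k) ≗ λ j → negBinom k j ℕ.+ u j
  pascal j = sym (nCk+nC[k+1]≡[n+1]C[k+1] (k ℕ.+ j) k)
  u∘suc : u ∘ suc ≗ negBinom (suc k)
  u∘suc j = cong (_C suc k) (ℕ.+-suc k j)
  atPred-cong : ∀ M → atPred (composeXPlusX² (u ∘ suc)) M ≡ atPred (snkDiag (suc k)) M
  atPred-cong zero    = refl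
  atPred-cong (suc M) = composeXPlusX²-cong u∘suc M

snk-above : ∀ {n k} → n < k → snk n k ≡ 0
snk-above {n} {k} n<k rewrite dec-false (k ℕ.≤? n) (ℕ.<⇒≱ n<k) = refl

snk-diag : ∀ k N → snk (k ℕ.+ N) k ≡ snkDiag k N
snk-diag k N rewrite dec-true (k ℕ.≤? k ℕ.+ N) (ℕ.m≤m+n k N) | ℕ.m+n∸m≡n k N =
  ΣN-cong N (λ j _ → cong (λ r → negBinom k j ℕ.* (j C r)) (k+N∸j∸k j))
  where
  k+N∸j∸k : ∀ j → k ℕ.+ N ∸ j ∸ k ≡ N ∸ j
  k+N∸j∸k j = begin
    k ℕ.+ N ∸ j ∸ k     ≡⟨ ℕ.∸-+-assoc (k ℕ.+ N) j k ⟩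
    k ℕ.+ N ∸ (j ℕ.+ k) ≡⟨ cong (k ℕ.+ N ∸_) (ℕ.+-comm j k) ⟩
    k ℕ.+ N ∸ (k ℕ.+ j) ≡⟨ ℕ.[m+n]∸[m+o]≡n∸o k N j ⟩
    N ∸ j               ∎

snk-diag′ : ∀ k N {n} → n ≡ k ℕ.+ N → snk n k ≡ snkDiag k N
snk-diag′ k N refl = snk-diag k N

snk-diagonal : ∀ k → snk k k ≡ 1
snk-diagonal k = trans (snk-diag′ k 0 (sym (ℕ.+-identityʳ k))) (snkDiag-zero k)

snk-rec : ∀ n k → snk (suc (suc n)) k ≡ atPred (snk (suc n)) k ℕ.+ snk (suc n) k ℕ.+ snk n k
snk-rec n zero = begin
  snk (suc (suc n)) 0                 ≡⟨ snk-diag 0 (suc (suc n)) ⟩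
  snkDiag 0 (suc (suc n))             ≡⟨ snkDiag-suc₀ (suc n) ⟩
  snkDiag 0 (suc n) ℕ.+ snkDiag 0 n   ≡⟨ cong₂ ℕ._+_ (snk-diag 0 (suc n)) (snk-diag 0 n) ⟨
  snk (suc n) 0 ℕ.+ snk n 0           ∎
snk-rec n (suc k) with k ℕ.≤? n
... | yes k≤n = subst (λ n → snk (suc (suc n)) (suc k) ≡ snk (suc n) k ℕ.+ snk (suc n) (suc k) ℕ.+ snk n (suc k))
                      (ℕ.m+[n∸m]≡n k≤n) (offset (n ∸ k))
  where
  lowest : ∀ d → snk (k ℕ.+ d) (suc k) ≡ atPred (snkDiag (suc k)) d
  lowest zero    = snk-above (s≤s (ℕ.≤-reflexive (ℕ.+-identityʳ k)))
  lowest (suc d) = snk-diag′ (suc k) d (ℕ.+-suc k d)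
  offset : ∀ d → snk (suc (suc (k ℕ.+ d))) (suc k) ≡ snk (suc (k ℕ.+ d)) k ℕ.+ snk (suc (k ℕ.+ d)) (suc k) ℕ.+ snk (k ℕ.+ d) (suc k)
  offset d = begin
    snk (suc (suc (k ℕ.+ d))) (suc k)
      ≡⟨ snk-diag′ (suc k) (suc d) (cong suc (sym (ℕ.+-suc k d))) ⟩
    snkDiag (suc k) (suc d)
      ≡⟨ snkDiag-suc k d ⟩
    snkDiag k (suc d) ℕ.+ snkDiag (suc k) d ℕ.+ atPred (snkDiag (suc k)) d
      ≡⟨ cong₂ ℕ._+_ (cong₂ ℕ._+_ (snk-diag′ k (suc d) (sym (ℕ.+-suc k d))) (snk-diag (suc k) d)) (lowest d) ⟨
    snk (suc (k ℕ.+ d)) k ℕ.+ snk (suc (k ℕ.+ d)) (suc k) ℕ.+ snk (k ℕ.+ d) (suc k) ∎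
... | no k≰n with ℕ.m≤n⇒m<n∨m≡n (ℕ.≰⇒> k≰n)
...   | inj₂ refl = trans (snk-diagonal (suc (suc n)))
  (sym (cong₂ ℕ._+_ (cong₂ ℕ._+_ (snk-diagonal (suc n)) (snk-above (ℕ.n<1+n (suc n))))
                    (snk-above (ℕ.m<n⇒m<1+n (ℕ.n<1+n n)))))
...   | inj₁ n<k = trans (snk-above (s≤s n<k))
  (sym (cong₂ ℕ._+_ (cong₂ ℕ._+_ (snk-above n<k) (snk-above (s≤s (ℕ.<⇒≤ n<k))))
                    (snk-above (ℕ.m<n⇒m<1+n (ℕ.<⇒≤ n<k)))))

signedSnk : ℕ → ℕ → ℤ
signedSnk n k = sign (n ∸ k) * + snk n k

signedSnk-above : ∀ {n k} → n < k → signedSnk n k ≡ + 0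
signedSnk-above {n} {k} n<k = trans (cong (λ v → sign (n ∸ k) * + v) (snk-above n<k)) (ℤ.*-zeroʳ (sign (n ∸ k)))

sign-snk-suc : ∀ {M} N K → M ≤ N → sign (suc N ∸ K) * + snk M K ≡ - (sign (N ∸ K) * + snk M K)
sign-snk-suc {M} N K M≤N with K ℕ.≤? N
... | yes K≤N rewrite ℕ.+-∸-assoc 1 K≤N = sym (ℤ.neg-distribˡ-* (sign (N ∸ K)) (+ snk M K))
... | no K≰N rewrite snk-above (ℕ.≤-<-trans M≤N (ℕ.≰⇒> K≰N))
                   | ℤ.*-zeroʳ (sign (suc N ∸ K)) | ℤ.*-zeroʳ (sign (N ∸ K)) = refl

signedSnk-rec : ∀ n k → signedSnk (suc (suc n)) k ≡ xTimes (signedSnk (suc n)) k - signedSnk (suc n) k + signedSnk n k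
signedSnk-rec n zero = begin
  - - sign n * + (snk (suc (suc n)) 0)           ≡⟨ cong (λ v → - - sign n * + v) (snk-rec n 0) ⟩
  - - sign n * (+ (snk (suc n) 0 ℕ.+ snk n 0))   ≡⟨ cong (- - sign n *_) (ℤ.pos-+ (snk (suc n) 0) (snk n 0)) ⟩
  - - sign n * (+ snk (suc n) 0 + + snk n 0)     ≡⟨ reorder (sign n) (+ snk (suc n) 0) (+ snk n 0) ⟩
  + 0 - - sign n * + snk (suc n) 0 + sign n * + snk n 0 ∎
  where
  reorder : ∀ σ a b → - - σ * (a + b) ≡ + 0 - - σ * a + σ * b
  reorder = ℤ-Solver.solve-∀
signedSnk-rec n (suc k) = begin
  σ * + (snk (suc (suc n)) (suc k))
    ≡⟨ cong (λ v → σ * + v) (snk-rec n (suc k)) ⟩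
  σ * + (snk (suc n) k ℕ.+ snk (suc n) (suc k) ℕ.+ snk n (suc k))
    ≡⟨ cong (σ *_) (pos-+₃ (snk (suc n) k) (snk (suc n) (suc k)) (snk n (suc k))) ⟩
  σ * (+ snk (suc n) k + + snk (suc n) (suc k) + + snk n (suc k))
    ≡⟨ distrib σ (+ snk (suc n) k) (+ snk (suc n) (suc k)) (+ snk n (suc k)) ⟩
  σ * + snk (suc n) k + σ * + snk (suc n) (suc k) + σ * + snk n (suc k)
    ≡⟨ cong₂ (λ a b → σ * + snk (suc n) k + a + b) (sign-snk-suc (suc n) (suc k) ℕ.≤-refl) last ⟩
  signedSnk (suc n) k - signedSnk (suc n) (suc k) + signedSnk n (suc k) ∎
  where
  σ : ℤ
  σ = sign (suc n ∸ k)
  distrib : ∀ σ a b c → σ * (a + b + c) ≡ σ * a + σ * b + σ * c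
  distrib = ℤ-Solver.solve-∀
  last : σ * + snk n (suc k) ≡ signedSnk n (suc k)
  last = begin
    σ * + snk n (suc k)                        ≡⟨ sign-snk-suc (suc n) (suc k) (ℕ.n≤1+n n) ⟩
    - (sign (n ∸ k) * + snk n (suc k))         ≡⟨ cong -_ (sign-snk-suc n (suc k) ℕ.≤-refl) ⟩
    - - (sign (n ∸ suc k) * + snk n (suc k))   ≡⟨ ℤ.neg-involutive _ ⟩
    signedSnk n (suc k)                        ∎

ΣZ-signedSnk-pad : ∀ n d (f : ℕ → ℤ) → ΣZ (d ℕ.+ n) (λ k → signedSnk n k * f k) ≡ ΣZ n (λ k → signedSnk n k * f k)
ΣZ-signedSnk-pad n zero    f = refl
ΣZ-signedSnk-pad n (suc d) f = begin
  ΣZ (suc (d ℕ.+ n)) (λ k → signedSnk n k * f k)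
    ≡⟨ ΣZ-dropLast (d ℕ.+ n) _ (cong (_* f (suc (d ℕ.+ n))) (signedSnk-above (s≤s (ℕ.m≤n+m n d)))) ⟩
  ΣZ (d ℕ.+ n) (λ k → signedSnk n k * f k)
    ≡⟨ ΣZ-signedSnk-pad n d f ⟩
  ΣZ n (λ k → signedSnk n k * f k) ∎

⊛-cong : ∀ {f f′ g g′} → f ≗ f′ → g ≗ g′ → f ⊛ g ≗ f′ ⊛ g′
⊛-cong f≗f′ g≗g′ n = ΣZ-cong n (λ i _ → cong₂ _*_ (f≗f′ i) (g≗g′ (n ∸ i)))

⊛-comm : ∀ f g → f ⊛ g ≗ g ⊛ f
⊛-comm f g n = trans (ΣZ-reverse n (λ i → f i * g (n ∸ i)))
  (ΣZ-cong n (λ i i≤n → trans (ℤ.*-comm (f (n ∸ i)) _) (cong (λ j → g j * f (n ∸ i)) (ℕ.m∸[m∸n]≡n i≤n))))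

⊛-assoc : ∀ f g e → f ⊛ (g ⊛ e) ≗ (f ⊛ g) ⊛ e
⊛-assoc f g e n = begin
  ΣZ n (λ i → f i * ΣZ (n ∸ i) (λ j → g j * e (n ∸ i ∸ j)))
    ≡⟨ ΣZ-cong n (λ i _ → sym (ΣZ-*ˡ (n ∸ i) (f i) _)) ⟩
  ΣZ n (λ i → ΣZ (n ∸ i) (λ j → f i * (g j * e (n ∸ i ∸ j))))
    ≡⟨ ΣZ-triangle n (λ i j → f i * (g j * e (n ∸ i ∸ j))) ⟩
  ΣZ n (λ p → ΣZ p (λ i → f i * (g (p ∸ i) * e (n ∸ i ∸ (p ∸ i)))))
    ≡⟨ ΣZ-cong n (λ p p≤n → ΣZ-cong p (λ i i≤p →
         trans (sym (ℤ.*-assoc (f i) _ _)) (cong (λ j → f i * g (p ∸ i) * e j) (n∸i∸[p∸i] i≤p p≤n)))) ⟩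
  ΣZ n (λ p → ΣZ p (λ i → f i * g (p ∸ i) * e (n ∸ p)))
    ≡⟨ ΣZ-cong n (λ p _ → ΣZ-*ʳ p (e (n ∸ p)) _) ⟩
  ΣZ n (λ p → ΣZ p (λ i → f i * g (p ∸ i)) * e (n ∸ p)) ∎
  where
  n∸i∸[p∸i] : ∀ {i p} → i ≤ p → p ≤ n → n ∸ i ∸ (p ∸ i) ≡ n ∸ p
  n∸i∸[p∸i] {i} {p} i≤p _ = trans (ℕ.∸-+-assoc n i (p ∸ i)) (cong (n ∸_) (ℕ.m+[n∸m]≡n i≤p))

⊛-rotate : ∀ f g e → f ⊛ (g ⊛ e) ≗ (g ⊛ f) ⊛ e
⊛-rotate f g e n = trans (⊛-assoc f g e n) (⊛-cong {g = e} (⊛-comm f g) (λ _ → refl) n)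

oneS-⊛ : ∀ g → oneS ⊛ g ≗ g
oneS-⊛ g zero    = ℤ.*-identityˡ (g 0)
oneS-⊛ g (suc n) = begin
  ΣZ (suc n) (λ i → oneS i * g (suc n ∸ i))   ≡⟨ ΣZ-head (suc n) _ (λ _ → refl) ⟩
  + 1 * g (suc n)                             ≡⟨ ℤ.*-identityˡ (g (suc n)) ⟩
  g (suc n)                                   ∎

xTimes-cong : ∀ {f g} → f ≗ g → xTimes f ≗ xTimes g
xTimes-cong f≗g zero    = refl
xTimes-cong f≗g (suc n) = f≗g n

xTimes-⊛ : ∀ f g → xTimes f ⊛ g ≗ xTimes (f ⊛ g)
xTimes-⊛ f g zero    = refl
xTimes-⊛ f g (suc n) = trans (ΣZ-unfoldˡ n (λ i → xTimes f i * g (suc n ∸ i))) (ℤ.+-identityˡ _)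

xTimes-xPow : ∀ k → xTimes (xPow k) ≗ xPow (suc k)
xTimes-xPow k zero    = refl
xTimes-xPow k (suc n) = refl

oneMinusXMinusX²-⊛ : ∀ g n → (oneMinusXMinusX² ⊛ g) n ≡ g n - xTimes g n - xTimes (xTimes g) n
oneMinusXMinusX²-⊛ g zero          = trans (ℤ.*-identityˡ (g 0)) (sym (trans (ℤ.+-identityʳ _) (ℤ.+-identityʳ _)))
oneMinusXMinusX²-⊛ g (suc zero)    = simplify (g 1) (g 0)
  where
  simplify : ∀ a b → + 1 * a + - + 1 * b ≡ a - b - + 0
  simplify = ℤ-Solver.solve-∀
oneMinusXMinusX²-⊛ g (suc (suc n)) = begin
  ΣZ (suc (suc n)) (λ i → Q i * g (suc (suc n) ∸ i))
    ≡⟨ ΣZ-unfoldˡ (suc n) _ ⟩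
  + 1 * g (suc (suc n)) + ΣZ (suc n) (λ i → Q (suc i) * g (suc n ∸ i))
    ≡⟨ cong (_+_ (+ 1 * g (suc (suc n)))) (ΣZ-unfoldˡ n _) ⟩
  + 1 * g (suc (suc n)) + (- + 1 * g (suc n) + ΣZ n (λ i → Q (suc (suc i)) * g (n ∸ i)))
    ≡⟨ cong (λ t → + 1 * g (suc (suc n)) + (- + 1 * g (suc n) + t)) (ΣZ-head n _ (λ _ → refl)) ⟩
  + 1 * g (suc (suc n)) + (- + 1 * g (suc n) + - + 1 * g n)
    ≡⟨ simplify (g (suc (suc n))) (g (suc n)) (g n) ⟩
  g (suc (suc n)) - g (suc n) - g n ∎
  where
  Q = oneMinusXMinusX²
  simplify : ∀ a b c → + 1 * a + (- + 1 * b + - + 1 * c) ≡ a - b - c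
  simplify = ℤ-Solver.solve-∀

oneMinusXMinusX²-⊛-snkGF : ∀ k n → (oneMinusXMinusX² ⊛ snkGF k) (suc (suc n)) ≡ + atPred (snk (suc n)) k
oneMinusXMinusX²-⊛-snkGF k n = begin
  (oneMinusXMinusX² ⊛ snkGF k) (suc (suc n))
    ≡⟨ oneMinusXMinusX²-⊛ (snkGF k) (suc (suc n)) ⟩
  + snk (suc (suc n)) k - + snk (suc n) k - + snk n k
    ≡⟨ cong (λ v → + v - + snk (suc n) k - + snk n k) (snk-rec n k) ⟩
  + (atPred (snk (suc n)) k ℕ.+ snk (suc n) k ℕ.+ snk n k) - + snk (suc n) k - + snk n k
    ≡⟨ cong (λ v → v - + snk (suc n) k - + snk n k) (pos-+₃ (atPred (snk (suc n)) k) _ _) ⟩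
  + atPred (snk (suc n)) k + + snk (suc n) k + + snk n k - + snk (suc n) k - + snk n k
    ≡⟨ cancel (+ atPred (snk (suc n)) k) (+ snk (suc n) k) (+ snk n k) ⟩
  + atPred (snk (suc n)) k ∎
  where
  cancel : ∀ a b c → a + b + c - b - c ≡ a
  cancel = ℤ-Solver.solve-∀

oneMinusXMinusX²-⊛-snkGF₀ : oneMinusXMinusX² ⊛ snkGF 0 ≗ oneS
oneMinusXMinusX²-⊛-snkGF₀ zero          = refl
oneMinusXMinusX²-⊛-snkGF₀ (suc zero)    = refl
oneMinusXMinusX²-⊛-snkGF₀ (suc (suc n)) = oneMinusXMinusX²-⊛-snkGF 0 n

oneMinusXMinusX²-⊛-snkGF-suc : ∀ k → oneMinusXMinusX² ⊛ snkGF (suc k) ≗ xTimes (snkGF k)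
oneMinusXMinusX²-⊛-snkGF-suc k       zero          = refl
oneMinusXMinusX²-⊛-snkGF-suc zero    (suc zero)    = refl
oneMinusXMinusX²-⊛-snkGF-suc (suc k) (suc zero)    = refl
oneMinusXMinusX²-⊛-snkGF-suc k       (suc (suc n)) = oneMinusXMinusX²-⊛-snkGF (suc k) n

snkGF-⊛-power : ∀ k → snkGF k ⊛ (oneMinusXMinusX² ^S suc k) ≗ xPow k
snkGF-⊛-power zero n = begin
  (snkGF 0 ⊛ (Q ⊛ oneS)) n  ≡⟨ ⊛-rotate (snkGF 0) Q oneS n ⟩
  ((Q ⊛ snkGF 0) ⊛ oneS) n  ≡⟨ ⊛-cong {g = oneS} oneMinusXMinusX²-⊛-snkGF₀ (λ _ → refl) n ⟩
  (oneS ⊛ oneS) n           ≡⟨ oneS-⊛ oneS n ⟩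
  oneS n                    ≡⟨ oneS≗xPow₀ n ⟩
  xPow 0 n                  ∎
  where
  Q = oneMinusXMinusX²
  oneS≗xPow₀ : oneS ≗ xPow 0
  oneS≗xPow₀ zero    = refl
  oneS≗xPow₀ (suc n) = refl
snkGF-⊛-power (suc k) n = begin
  (snkGF (suc k) ⊛ (Q ⊛ Qᵏ⁺¹)) n    ≡⟨ ⊛-rotate (snkGF (suc k)) Q Qᵏ⁺¹ n ⟩
  ((Q ⊛ snkGF (suc k)) ⊛ Qᵏ⁺¹) n    ≡⟨ ⊛-cong {g = Qᵏ⁺¹} (oneMinusXMinusX²-⊛-snkGF-suc k) (λ _ → refl) n ⟩
  (xTimes (snkGF k) ⊛ Qᵏ⁺¹) n       ≡⟨ xTimes-⊛ (snkGF k) Qᵏ⁺¹ n ⟩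
  xTimes (snkGF k ⊛ Qᵏ⁺¹) n         ≡⟨ xTimes-cong (snkGF-⊛-power k) n ⟩
  xTimes (xPow k) n                 ≡⟨ xTimes-xPow k n ⟩
  xPow (suc k) n                    ∎
  where
  Q = oneMinusXMinusX²
  Qᵏ⁺¹ = oneMinusXMinusX² ^S suc k

-- Fibonacci polynomials of an operator

Profile : Set
Profile = ℕ → ℤ

module FibonacciExpansion
  (A : Profile → Profile)
  (A-cong : ∀ {f g} → f ≗ g → A f ≗ A g)
  (A-linear : ∀ n (a : ℕ → ℤ) (f : ℕ → Profile) →
              A (λ y → ΣZ n (λ k → a k * f k y)) ≗ λ x → ΣZ n (λ k → a k * A (f k) x))
  (F G : ℕ → Profile)
  (F-suc : ∀ k → F (suc k) ≗ λ x → A (F k) x + F k x)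
  (G-zero : G 0 ≗ F 0)
  (G-one : G 1 ≗ A (F 0))
  (G-suc-suc : ∀ n → G (suc (suc n)) ≗ λ x → A (G (suc n)) x + G n x)
  where

  A-shift : ∀ N (a : ℕ → ℤ) x →
            A (λ y → ΣZ N (λ k → a k * F k y)) x ≡ ΣZ (suc N) (λ k → xTimes a k * F k x) - ΣZ N (λ k → a k * F k x)
  A-shift N a x = begin
    A (λ y → ΣZ N (λ k → a k * F k y)) x
      ≡⟨ A-linear N a F x ⟩
    ΣZ N (λ k → a k * A (F k) x)
      ≡⟨ ΣZ-cong N (λ k _ → A-step k) ⟩
    ΣZ N (λ k → a k * F (suc k) x - a k * F k x)
      ≡⟨ ΣZ-- N _ _ ⟩
    ΣZ N (λ k → a k * F (suc k) x) - ΣZ N (λ k → a k * F k x)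
      ≡⟨ cong (_- ΣZ N (λ k → a k * F k x)) (ΣZ-xTimes N a (λ k → F k x)) ⟨
    ΣZ (suc N) (λ k → xTimes a k * F k x) - ΣZ N (λ k → a k * F k x) ∎
    where
    A-step : ∀ k → a k * A (F k) x ≡ a k * F (suc k) x - a k * F k x
    A-step k = begin
      a k * A (F k) x                          ≡⟨ expand (a k) (A (F k) x) (F k x) ⟩
      a k * (A (F k) x + F k x) - a k * F k x   ≡⟨ cong (λ t → a k * t - a k * F k x) (F-suc k x) ⟨
      a k * F (suc k) x - a k * F k x           ∎
      where
      expand : ∀ γ a p → γ * a ≡ γ * (a + p) - γ * p
      expand = ℤ-Solver.solve-∀

  expansion : ∀ n → G n ≗ λ x → ΣZ n (λ k → signedSnk n k * F k x)
  expansion zero          x = trans (G-zero x) (sym (ℤ.*-identityˡ (F 0 x)))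
  expansion (suc zero)    x = begin
    G 1 x                                     ≡⟨ G-one x ⟩
    A (F 0) x                                 ≡⟨ simplify (A (F 0) x) (F 0 x) ⟩
    - + 1 * F 0 x + + 1 * (A (F 0) x + F 0 x) ≡⟨ cong (λ t → - + 1 * F 0 x + + 1 * t) (F-suc 0 x) ⟨
    - + 1 * F 0 x + + 1 * F 1 x               ∎
    where
    simplify : ∀ a p → a ≡ - + 1 * p + + 1 * (a + p)
    simplify = ℤ-Solver.solve-∀
  expansion (suc (suc n)) x = begin
    G (2+ n) x
      ≡⟨ G-suc-suc n x ⟩
    A (G (1+ n)) x + G n x
      ≡⟨ cong₂ _+_ (trans (A-cong (expansion (suc n)) x) (A-shift (1+ n) (c (1+ n)) x)) (expansion n x) ⟩
    ΣZ (2+ n) (λ k → xTimes (c (1+ n)) k * P k) - ΣZ (1+ n) (λ k → c (1+ n) k * P k) + ΣZ n (λ k → c n k * P k)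
      ≡⟨ cong₂ (λ a b → ΣZ (2+ n) (λ k → xTimes (c (1+ n)) k * P k) - a + b)
               (ΣZ-signedSnk-pad (1+ n) 1 P) (ΣZ-signedSnk-pad n 2 P) ⟨
    ΣZ (2+ n) (λ k → xTimes (c (1+ n)) k * P k) - ΣZ (2+ n) (λ k → c (1+ n) k * P k) + ΣZ (2+ n) (λ k → c n k * P k)
      ≡⟨ ΣZ-combine (2+ n) (xTimes (c (1+ n))) (c (1+ n)) (c n) P ⟩
    ΣZ (2+ n) (λ k → (xTimes (c (1+ n)) k - c (1+ n) k + c n k) * P k)
      ≡⟨ ΣZ-cong (2+ n) (λ k _ → cong (_* P k) (sym (signedSnk-rec n k))) ⟩
    ΣZ (2+ n) (λ k → c (2+ n) k * P k) ∎
    where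
    c = signedSnk
    P : ℕ → ℤ
    P k = F k x
    1+_ 2+_ : ℕ → ℕ
    1+ m = suc m
    2+ m = suc (suc m)

stepEq-sound : ∀ {s t} → T (stepEq s t) → s ≡ t
stepEq-sound {U} {U} _ = refl
stepEq-sound {D} {D} _ = refl
stepEq-sound {h} {h} _ = refl
stepEq-sound {H} {H} _ = refl
stepEq-sound {U} {D} ()
stepEq-sound {U} {h} ()
stepEq-sound {U} {H} ()
stepEq-sound {D} {U} ()
stepEq-sound {D} {h} ()
stepEq-sound {D} {H} ()
stepEq-sound {h} {U} ()
stepEq-sound {h} {D} ()
stepEq-sound {h} {H} ()
stepEq-sound {H} {U} ()
stepEq-sound {H} {D} ()
stepEq-sound {H} {h} ()

pathEq-sound : ∀ p q → T (pathEq p q) → p ≡ q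
pathEq-sound []      []      _  = refl
pathEq-sound (s ∷ p) (t ∷ q) eq with T-∧ {stepEq s t} .Equivalence.to eq
... | s≡t , p≡q = cong₂ _∷_ (stepEq-sound s≡t) (pathEq-sound p q p≡q)

take-length-++ : ∀ (p q : List Step) → take (length p) (p ++ q) ≡ p
take-length-++ []      q = refl
take-length-++ (s ∷ p) q = cong (s ∷_) (take-length-++ p q)

drop-length-++ : ∀ (p q : List Step) → drop (length p) (p ++ q) ≡ q
drop-length-++ []      q = refl
drop-length-++ (s ∷ p) q = drop-length-++ p q

length-mirror : ∀ p → length (mirror p) ≡ length p
length-mirror p = trans (length-reverse (map mirrorStep p)) (length-map mirrorStep p)

mirror-∷ : ∀ s p r → mirror (s ∷ p) ++ r ≡ mirror p ++ mirrorStep s ∷ r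
mirror-∷ s p r = trans (cong (_++ r) (unfold-reverse (mirrorStep s) (map mirrorStep p)))
                       (++-assoc (mirror p) (mirrorStep s ∷ []) r)

allB-++ : ∀ P (p q : List Step) → allB P (p ++ q) ≡ allB P p ∧ allB P q
allB-++ P []      q = refl
allB-++ P (s ∷ p) q = trans (cong (P s ∧_) (allB-++ P p q)) (sym (∧-assoc (P s) (allB P p) (allB P q)))

allB-mirror : ∀ P → (∀ s → P (mirrorStep s) ≡ P s) → ∀ p → allB P (mirror p) ≡ allB P p
allB-mirror P P-mirror []      = refl
allB-mirror P P-mirror (s ∷ p) = begin
  allB P (mirror (s ∷ p))                  ≡⟨ cong (allB P) (trans (sym (++-identityʳ _)) (mirror-∷ s p [])) ⟩
  allB P (mirror p ++ mirrorStep s ∷ [])   ≡⟨ allB-++ P (mirror p) _ ⟩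
  allB P (mirror p) ∧ (P (mirrorStep s) ∧ true)
                                           ≡⟨ cong₂ (λ a b → a ∧ (b ∧ true)) (allB-mirror P P-mirror p) (P-mirror s) ⟩
  allB P p ∧ (P s ∧ true)                  ≡⟨ cong (allB P p ∧_) (∧-identityʳ (P s)) ⟩
  allB P p ∧ P s                           ≡⟨ ∧-comm (allB P p) (P s) ⟩
  P s ∧ allB P p                           ∎

pathWidth-++ : ∀ (p q : List Step) → pathWidth (p ++ q) ≡ pathWidth p ℕ.+ pathWidth q
pathWidth-++ []      q = refl
pathWidth-++ (s ∷ p) q = trans (cong (width s ℕ.+_) (pathWidth-++ p q)) (sym (ℕ.+-assoc (width s) _ _))

pathWidth-mirror : ∀ p → pathWidth (mirror p) ≡ pathWidth p
pathWidth-mirror []      = refl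
pathWidth-mirror (s ∷ p) = begin
  pathWidth (mirror (s ∷ p))                       ≡⟨ cong pathWidth (trans (sym (++-identityʳ _)) (mirror-∷ s p [])) ⟩
  pathWidth (mirror p ++ mirrorStep s ∷ [])        ≡⟨ pathWidth-++ (mirror p) _ ⟩
  pathWidth (mirror p) ℕ.+ (width (mirrorStep s) ℕ.+ 0)
                                                   ≡⟨ cong₂ ℕ._+_ (pathWidth-mirror p) (ℕ.+-identityʳ _) ⟩
  pathWidth p ℕ.+ width (mirrorStep s)             ≡⟨ ℕ.+-comm (pathWidth p) _ ⟩
  width (mirrorStep s) ℕ.+ pathWidth p             ≡⟨ cong (ℕ._+ pathWidth p) (width-mirrorStep s) ⟩
  width s ℕ.+ pathWidth p                          ∎
  where
  width-mirrorStep : ∀ s → width (mirrorStep s) ≡ width s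
  width-mirrorStep U = refl
  width-mirrorStep D = refl
  width-mirrorStep h = refl
  width-mirrorStep H = refl

length≤pathWidth : ∀ p → length p ≤ pathWidth p
length≤pathWidth []      = z≤n
length≤pathWidth (U ∷ p) = s≤s (length≤pathWidth p)
length≤pathWidth (D ∷ p) = s≤s (length≤pathWidth p)
length≤pathWidth (h ∷ p) = s≤s (length≤pathWidth p)
length≤pathWidth (H ∷ p) = s≤s (ℕ.m≤n⇒m≤1+n (length≤pathWidth p))

double-injective : ∀ {i j} → i ℕ.+ i ≡ j ℕ.+ j → i ≡ j
double-injective {i} {j} eq = trans (ℕ.n≡⌊n+n/2⌋ i) (trans (cong ℕ.⌊_/2⌋ eq) (sym (ℕ.n≡⌊n+n/2⌋ j)))

odd≢double : ∀ i j → suc (i ℕ.+ i) ≢ j ℕ.+ j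
odd≢double i j eq = ℕ.even≢odd j i (trans (double j) (trans (sym eq) (cong suc (sym (double i)))))
  where
  double : ∀ m → 2 ℕ.* m ≡ m ℕ.+ m
  double m = cong (m ℕ.+_) (ℕ.+-identityʳ m)

double-≡ᵇ : ∀ a b → (a ℕ.+ a ≡ᵇ b ℕ.+ b) ≡ (a ≡ᵇ b)
double-≡ᵇ zero    zero    = refl
double-≡ᵇ zero    (suc b) = refl
double-≡ᵇ (suc a) zero    = refl
double-≡ᵇ (suc a) (suc b) rewrite ℕ.+-suc a a | ℕ.+-suc b b = double-≡ᵇ a b

symmetricAt : ℕ → List Step → ℕ → Bool
symmetricAt n q i = (pathWidth (take i q) ≡ᵇ n) ∧ pathEq (drop i q) (mirror (take i q))

any-unique : ∀ {A : Set} (t : A → Bool) (g : List A → Bool) →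
             g [] ≡ false → (∀ x xs → g (x ∷ xs) ≡ (t x ∨ g xs)) → ∀ xs → g xs ≡ any t xs
any-unique t g g[] g∷ []       = g[]
any-unique t g g[] g∷ (x ∷ xs) = trans (g∷ x xs) (cong (t x ∨_) (any-unique t g g[] g∷ xs))

any-false : ∀ {A : Set} (t : A → Bool) xs → (∀ {j} → j ∈ xs → ¬ T (t j)) → any t xs ≡ false
any-false t []       none = refl
any-false t (x ∷ xs) none with t x in tx
... | true  = contradiction (subst T (sym tx) tt) (none (here refl))
... | false = any-false t xs (none ∘ there)

any-unique-witness : ∀ {A : Set} (t : A → Bool) xs {i} → i ∈ xs → (∀ {j} → j ∈ xs → T (t j) → j ≡ i) → any t xs ≡ t i
any-unique-witness t xs {i} i∈xs only-i with t i in ti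
... | false = any-false t xs (λ j∈xs tj → subst T ti (subst (T ∘ t) (only-i j∈xs tj) tj))
... | true  = T-≡ .Equivalence.to (any⁺ t (Any.map (λ { refl → subst T (sym ti) tt }) i∈xs))

-- The recursion inside isSymmetric is local to it; abstracting the list of indices lets Agda
-- identify it with any through the two equations it satisfies.
isSymmetric-any : ∀ n q → isSymmetric n q ≡ any (symmetricAt n q) (upTo (suc (length q)))
isSymmetric-any n q with any-unique (symmetricAt n q) _ refl (λ _ _ → refl) | applyUpTo suc (length q)
... | go≡any | indices = cong (symmetricAt n q 0 ∨_) (go≡any indices)

symmetricAt-length : ∀ n q i → i ≤ length q → T (symmetricAt n q i) → length q ≡ i ℕ.+ i
symmetricAt-length n q i i≤len sym with T-∧ {pathWidth (take i q) ≡ᵇ n} .Equivalence.to sym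
... | _ , mirrored = begin
  length q                   ≡⟨ ℕ.m+[n∸m]≡n i≤len ⟨
  i ℕ.+ (length q ∸ i)       ≡⟨ cong (i ℕ.+_) half ⟩
  i ℕ.+ i                    ∎
  where
  half : length q ∸ i ≡ i
  half = begin
    length q ∸ i                  ≡⟨ length-drop i q ⟨
    length (drop i q)             ≡⟨ cong length (pathEq-sound (drop i q) (mirror (take i q)) mirrored) ⟩
    length (mirror (take i q))    ≡⟨ length-mirror (take i q) ⟩
    length (take i q)             ≡⟨ length-take i q ⟩
    i ℕ.⊓ length q                ≡⟨ ℕ.m≤n⇒m⊓n≡m i≤len ⟩
    i                             ∎

isSymmetric-odd : ∀ n q i → length q ≡ suc (i ℕ.+ i) → isSymmetric n q ≡ false
isSymmetric-odd n q i odd = trans (isSymmetric-any n q) (any-false _ _ not-symmetricAt)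
  where
  not-symmetricAt : ∀ {j} → j ∈ upTo (suc (length q)) → ¬ T (symmetricAt n q j)
  not-symmetricAt {j} j∈ symj =
    odd≢double i j (trans (sym odd) (symmetricAt-length n q j (ℕ.s≤s⁻¹ (∈-upTo⁻ j∈)) symj))

isSymmetric-halves : ∀ n p q → length p ≡ length q → isSymmetric n (p ++ q) ≡ (pathWidth p ≡ᵇ n) ∧ pathEq q (mirror p)
isSymmetric-halves n p q |p|≡|q| = begin
  isSymmetric n (p ++ q)                                       ≡⟨ isSymmetric-any n (p ++ q) ⟩
  any (symmetricAt n (p ++ q)) (upTo (suc (length (p ++ q))))  ≡⟨ any-unique-witness _ _ middle∈ only-middle ⟩
  symmetricAt n (p ++ q) (length p)                            ≡⟨ cong₂ (λ a b → (pathWidth a ≡ᵇ n) ∧ pathEq b (mirror a))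
                                                                        (take-length-++ p q) (drop-length-++ p q) ⟩
  (pathWidth p ≡ᵇ n) ∧ pathEq q (mirror p)                     ∎
  where
  |p++q| : length (p ++ q) ≡ length p ℕ.+ length p
  |p++q| = trans (length-++ p) (cong (length p ℕ.+_) (sym |p|≡|q|))
  middle∈ : length p ∈ upTo (suc (length (p ++ q)))
  middle∈ = ∈-upTo⁺ (s≤s (subst (length p ≤_) (sym |p++q|) (ℕ.m≤m+n (length p) (length p))))
  only-middle : ∀ {j} → j ∈ upTo (suc (length (p ++ q))) → T (symmetricAt n (p ++ q) j) → j ≡ length p
  only-middle {j} j∈ symj =
    double-injective (trans (sym (symmetricAt-length n (p ++ q) j (ℕ.s≤s⁻¹ (∈-upTo⁻ j∈)) symj)) |p++q|)

staysNonNeg : ℕ → List Step → Bool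
staysNonNeg ht []            = true
staysNonNeg ht (U ∷ p)       = staysNonNeg (suc ht) p
staysNonNeg zero (D ∷ p)     = false
staysNonNeg (suc ht) (D ∷ p) = staysNonNeg ht p
staysNonNeg ht (h ∷ p)       = staysNonNeg ht p
staysNonNeg ht (H ∷ p)       = staysNonNeg ht p

nonNegEndsZero-U : ∀ ht p → nonNegEndsZero ht (U ∷ p) ≡ nonNegEndsZero (suc ht) p
nonNegEndsZero-U zero    p = refl
nonNegEndsZero-U (suc _) p = refl

nonNegEndsZero-h : ∀ ht p → nonNegEndsZero ht (h ∷ p) ≡ nonNegEndsZero ht p
nonNegEndsZero-h zero    p = refl
nonNegEndsZero-h (suc _) p = refl

nonNegEndsZero-H : ∀ ht p → nonNegEndsZero ht (H ∷ p) ≡ nonNegEndsZero ht p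
nonNegEndsZero-H zero    p = refl
nonNegEndsZero-H (suc _) p = refl

nonNegEndsZero-mirror : ∀ ht p r → nonNegEndsZero ht (p ++ mirror p ++ r) ≡ staysNonNeg ht p ∧ nonNegEndsZero ht r
nonNegEndsZero-mirror ht       []      r = refl
nonNegEndsZero-mirror ht       (U ∷ p) r = begin
  nonNegEndsZero ht (U ∷ p ++ mirror (U ∷ p) ++ r)       ≡⟨ nonNegEndsZero-U ht _ ⟩
  nonNegEndsZero (suc ht) (p ++ mirror (U ∷ p) ++ r)     ≡⟨ cong (λ t → nonNegEndsZero (suc ht) (p ++ t)) (mirror-∷ U p r) ⟩
  nonNegEndsZero (suc ht) (p ++ mirror p ++ D ∷ r)       ≡⟨ nonNegEndsZero-mirror (suc ht) p (D ∷ r) ⟩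
  staysNonNeg (suc ht) p ∧ nonNegEndsZero ht r           ∎
nonNegEndsZero-mirror zero     (D ∷ p) r = refl
nonNegEndsZero-mirror (suc ht) (D ∷ p) r = begin
  nonNegEndsZero ht (p ++ mirror (D ∷ p) ++ r)           ≡⟨ cong (λ t → nonNegEndsZero ht (p ++ t)) (mirror-∷ D p r) ⟩
  nonNegEndsZero ht (p ++ mirror p ++ U ∷ r)             ≡⟨ nonNegEndsZero-mirror ht p (U ∷ r) ⟩
  staysNonNeg ht p ∧ nonNegEndsZero ht (U ∷ r)           ≡⟨ cong (staysNonNeg ht p ∧_) (nonNegEndsZero-U ht r) ⟩
  staysNonNeg ht p ∧ nonNegEndsZero (suc ht) r           ∎
nonNegEndsZero-mirror ht       (h ∷ p) r = begin
  nonNegEndsZero ht (h ∷ p ++ mirror (h ∷ p) ++ r)       ≡⟨ nonNegEndsZero-h ht _ ⟩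
  nonNegEndsZero ht (p ++ mirror (h ∷ p) ++ r)           ≡⟨ cong (λ t → nonNegEndsZero ht (p ++ t)) (mirror-∷ h p r) ⟩
  nonNegEndsZero ht (p ++ mirror p ++ h ∷ r)             ≡⟨ nonNegEndsZero-mirror ht p (h ∷ r) ⟩
  staysNonNeg ht p ∧ nonNegEndsZero ht (h ∷ r)           ≡⟨ cong (staysNonNeg ht p ∧_) (nonNegEndsZero-h ht r) ⟩
  staysNonNeg ht p ∧ nonNegEndsZero ht r                 ∎
nonNegEndsZero-mirror ht       (H ∷ p) r = begin
  nonNegEndsZero ht (H ∷ p ++ mirror (H ∷ p) ++ r)       ≡⟨ nonNegEndsZero-H ht _ ⟩
  nonNegEndsZero ht (p ++ mirror (H ∷ p) ++ r)           ≡⟨ cong (λ t → nonNegEndsZero ht (p ++ t)) (mirror-∷ H p r) ⟩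
  nonNegEndsZero ht (p ++ mirror p ++ H ∷ r)             ≡⟨ nonNegEndsZero-mirror ht p (H ∷ r) ⟩
  staysNonNeg ht p ∧ nonNegEndsZero ht (H ∷ r)           ≡⟨ cong (staysNonNeg ht p ∧_) (nonNegEndsZero-H ht r) ⟩
  staysNonNeg ht p ∧ nonNegEndsZero ht r                 ∎

-- isMotzkin and isSchroder are isExcursion motzkinStep and isExcursion schroderStep.
isExcursion : (Step → Bool) → ℕ → List Step → Bool
isExcursion ok n q = allB ok q ∧ (pathWidth q ≡ᵇ n ℕ.+ n) ∧ nonNegEndsZero 0 q

isMeander : (Step → Bool) → ℕ → ℕ → List Step → Bool
isMeander ok ht n p = allB ok p ∧ (pathWidth p ≡ᵇ n) ∧ staysNonNeg ht p

isExcursion-mirror : ∀ ok → (∀ s → ok (mirrorStep s) ≡ ok s) → ∀ n p → isExcursion ok n (p ++ mirror p) ≡ isMeander ok 0 n p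
isExcursion-mirror ok ok-mirror n p = begin
  allB ok (p ++ mirror p) ∧ (pathWidth (p ++ mirror p) ≡ᵇ n ℕ.+ n) ∧ nonNegEndsZero 0 (p ++ mirror p)
    ≡⟨ cong₂ _∧_ (trans (allB-++ ok p (mirror p)) (cong (allB ok p ∧_) (allB-mirror ok ok-mirror p))) (cong₂ _∧_ width≡ nonNeg≡) ⟩
  (allB ok p ∧ allB ok p) ∧ (pathWidth p ≡ᵇ n) ∧ staysNonNeg 0 p
    ≡⟨ cong (_∧ ((pathWidth p ≡ᵇ n) ∧ staysNonNeg 0 p)) (∧-idem (allB ok p)) ⟩
  allB ok p ∧ (pathWidth p ≡ᵇ n) ∧ staysNonNeg 0 p ∎
  where
  width≡ : (pathWidth (p ++ mirror p) ≡ᵇ n ℕ.+ n) ≡ (pathWidth p ≡ᵇ n)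
  width≡ = begin
    (pathWidth (p ++ mirror p) ≡ᵇ n ℕ.+ n)                ≡⟨ cong (_≡ᵇ n ℕ.+ n) (pathWidth-++ p (mirror p)) ⟩
    (pathWidth p ℕ.+ pathWidth (mirror p) ≡ᵇ n ℕ.+ n)     ≡⟨ cong (λ w → pathWidth p ℕ.+ w ≡ᵇ n ℕ.+ n) (pathWidth-mirror p) ⟩
    (pathWidth p ℕ.+ pathWidth p ≡ᵇ n ℕ.+ n)              ≡⟨ double-≡ᵇ (pathWidth p) n ⟩
    (pathWidth p ≡ᵇ n)                                    ∎
  nonNeg≡ : nonNegEndsZero 0 (p ++ mirror p) ≡ staysNonNeg 0 p
  nonNeg≡ = begin
    nonNegEndsZero 0 (p ++ mirror p)          ≡⟨ cong (λ t → nonNegEndsZero 0 (p ++ t)) (++-identityʳ (mirror p)) ⟨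
    nonNegEndsZero 0 (p ++ mirror p ++ [])    ≡⟨ nonNegEndsZero-mirror 0 p [] ⟩
    staysNonNeg 0 p ∧ true                    ≡⟨ ∧-identityʳ (staysNonNeg 0 p) ⟩
    staysNonNeg 0 p                           ∎

symmetric-halves : ∀ ok → (∀ s → ok (mirrorStep s) ≡ ok s) → ∀ n p q → length p ≡ length q →
  (isExcursion ok n (p ++ q) ∧ isSymmetric n (p ++ q)) ≡ (isMeander ok 0 n p ∧ pathEq q (mirror p))
symmetric-halves ok ok-mirror n p q |p|≡|q| rewrite isSymmetric-halves n p q |p|≡|q| with pathEq q (mirror p) in mirrored
... | false = trans (cong (isExcursion ok n (p ++ q) ∧_) (∧-zeroʳ (pathWidth p ≡ᵇ n)))
                    (trans (∧-zeroʳ _) (sym (∧-zeroʳ _)))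
... | true with pathEq-sound q (mirror p) (subst T (sym mirrored) tt)
...   | refl = begin
  isExcursion ok n (p ++ mirror p) ∧ ((pathWidth p ≡ᵇ n) ∧ true)
    ≡⟨ cong₂ _∧_ (isExcursion-mirror ok ok-mirror n p) (∧-identityʳ _) ⟩
  (allB ok p ∧ (pathWidth p ≡ᵇ n) ∧ staysNonNeg 0 p) ∧ (pathWidth p ≡ᵇ n)
    ≡⟨ absorb (allB ok p) (pathWidth p ≡ᵇ n) (staysNonNeg 0 p) ⟩
  isMeander ok 0 n p
    ≡⟨ ∧-identityʳ _ ⟨
  isMeander ok 0 n p ∧ true ∎
  where
  absorb : ∀ a w s → (a ∧ w ∧ s) ∧ w ≡ a ∧ w ∧ s
  absorb true  true  s = ∧-identityʳ s
  absorb true  false s = refl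
  absorb false w     s = refl

mirror-invariant : ∀ (ok : Step → Bool) → ok U ≡ ok D → ∀ s → ok (mirrorStep s) ≡ ok s
mirror-invariant ok okU≡okD U = sym okU≡okD
mirror-invariant ok okU≡okD D = okU≡okD
mirror-invariant ok okU≡okD h = refl
mirror-invariant ok okU≡okD H = refl

indicator : Bool → ℕ
indicator b = if b then 1 else 0

indicator-∧ : ∀ a b → indicator (a ∧ b) ≡ indicator a ℕ.* indicator b
indicator-∧ true  b = sym (ℕ.+-identityʳ (indicator b))
indicator-∧ false b = refl

sumOver : {A : Set} → (A → ℕ) → List A → ℕ
sumOver f xs = sum (map f xs)

countB-sumOver : ∀ P xs → countB P xs ≡ sumOver (indicator ∘ P) xs
countB-sumOver P []       = refl
countB-sumOver P (x ∷ xs) = cong (indicator (P x) ℕ.+_) (countB-sumOver P xs)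

module _ {A : Set} where

  sumOver-++ : ∀ (f : A → ℕ) xs ys → sumOver f (xs ++ ys) ≡ sumOver f xs ℕ.+ sumOver f ys
  sumOver-++ f xs ys = trans (cong sum (map-++ f xs ys)) (sum-++ (map f xs) (map f ys))

  sumOver-cong : ∀ {f g : A → ℕ} → f ≗ g → ∀ xs → sumOver f xs ≡ sumOver g xs
  sumOver-cong f≗g xs = cong sum (map-cong f≗g xs)

  sumOver-+ : ∀ (f g : A → ℕ) xs → sumOver (λ x → f x ℕ.+ g x) xs ≡ sumOver f xs ℕ.+ sumOver g xs
  sumOver-+ f g []       = refl
  sumOver-+ f g (x ∷ xs) = trans (cong (f x ℕ.+ g x ℕ.+_) (sumOver-+ f g xs)) (ℕ+.interchange (f x) (g x) _ _)

  sumOver-*ˡ : ∀ k (f : A → ℕ) xs → sumOver (λ x → k ℕ.* f x) xs ≡ k ℕ.* sumOver f xs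
  sumOver-*ˡ k f []       = sym (ℕ.*-zeroʳ k)
  sumOver-*ˡ k f (x ∷ xs) = trans (cong (k ℕ.* f x ℕ.+_) (sumOver-*ˡ k f xs)) (sym (ℕ.*-distribˡ-+ k (f x) _))

  sumOver-zero : ∀ xs → sumOver (λ (_ : A) → 0) xs ≡ 0
  sumOver-zero []       = refl
  sumOver-zero (x ∷ xs) = sumOver-zero xs

sumOver-concatMap : ∀ {A B : Set} (f : B → ℕ) (g : A → List B) xs → sumOver f (concatMap g xs) ≡ sumOver (sumOver f ∘ g) xs
sumOver-concatMap f g []       = refl
sumOver-concatMap f g (x ∷ xs) = trans (sumOver-++ f (g x) (concatMap g xs)) (cong (sumOver f (g x) ℕ.+_) (sumOver-concatMap f g xs))

sumOver-applyUpTo : ∀ (g : ℕ → ℕ) f N → sumOver g (applyUpTo f (suc N)) ≡ ΣN N (g ∘ f)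
sumOver-applyUpTo g f zero    = ℕ.+-identityʳ (g (f 0))
sumOver-applyUpTo g f (suc N) = trans (cong (g (f 0) ℕ.+_) (sumOver-applyUpTo g (f ∘ suc) N)) (sym (ΣN-unfoldˡ N (g ∘ f)))

sumSteps : (Step → ℕ) → ℕ
sumSteps g = g U ℕ.+ g D ℕ.+ g h ℕ.+ g H

sumOver-sumSteps : ∀ {A : Set} (g : Step → A → ℕ) xs → sumOver (λ x → sumSteps (λ s → g s x)) xs ≡ sumSteps (λ s → sumOver (g s) xs)
sumOver-sumSteps g xs = begin
  sumOver (λ x → g U x ℕ.+ g D x ℕ.+ g h x ℕ.+ g H x) xs
    ≡⟨ sumOver-+ _ (g H) xs ⟩
  sumOver (λ x → g U x ℕ.+ g D x ℕ.+ g h x) xs ℕ.+ sumOver (g H) xs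
    ≡⟨ cong (ℕ._+ sumOver (g H) xs) (sumOver-+ _ (g h) xs) ⟩
  sumOver (λ x → g U x ℕ.+ g D x) xs ℕ.+ sumOver (g h) xs ℕ.+ sumOver (g H) xs
    ≡⟨ cong (λ t → t ℕ.+ sumOver (g h) xs ℕ.+ sumOver (g H) xs) (sumOver-+ (g U) (g D) xs) ⟩
  sumSteps (λ s → sumOver (g s) xs) ∎

ΣN-sumSteps : ∀ n (g : Step → ℕ → ℕ) → ΣN n (λ i → sumSteps (λ s → g s i)) ≡ sumSteps (λ s → ΣN n (g s))
ΣN-sumSteps n g = begin
  ΣN n (λ i → g U i ℕ.+ g D i ℕ.+ g h i ℕ.+ g H i)
    ≡⟨ ΣN-+ n _ (g H) ⟩
  ΣN n (λ i → g U i ℕ.+ g D i ℕ.+ g h i) ℕ.+ ΣN n (g H)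
    ≡⟨ cong (ℕ._+ ΣN n (g H)) (ΣN-+ n _ (g h)) ⟩
  ΣN n (λ i → g U i ℕ.+ g D i) ℕ.+ ΣN n (g h) ℕ.+ ΣN n (g H)
    ≡⟨ cong (λ t → t ℕ.+ ΣN n (g h) ℕ.+ ΣN n (g H)) (ΣN-+ n (g U) (g D)) ⟩
  sumSteps (λ s → ΣN n (g s)) ∎

sumSteps-stepEq : ∀ t b → sumSteps (λ s → indicator (stepEq s t ∧ b)) ≡ indicator b
sumSteps-stepEq U true  = refl
sumSteps-stepEq U false = refl
sumSteps-stepEq D true  = refl
sumSteps-stepEq D false = refl
sumSteps-stepEq h true  = refl
sumSteps-stepEq h false = refl
sumSteps-stepEq H true  = refl
sumSteps-stepEq H false = refl

sumOver-listsOfLength-suc : ∀ (f : List Step → ℕ) i →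
  sumOver f (listsOfLength (suc i)) ≡ sumOver (λ p → sumSteps (λ s → f (s ∷ p))) (listsOfLength i)
sumOver-listsOfLength-suc f i = begin
  sumOver f (concatMap (λ p → map (_∷ p) (U ∷ D ∷ h ∷ H ∷ [])) (listsOfLength i))
    ≡⟨ sumOver-concatMap f _ (listsOfLength i) ⟩
  sumOver (λ p → f (U ∷ p) ℕ.+ (f (D ∷ p) ℕ.+ (f (h ∷ p) ℕ.+ (f (H ∷ p) ℕ.+ 0)))) (listsOfLength i)
    ≡⟨ sumOver-cong (λ p → reassociate (f (U ∷ p)) (f (D ∷ p)) (f (h ∷ p)) (f (H ∷ p))) (listsOfLength i) ⟩
  sumOver (λ p → sumSteps (λ s → f (s ∷ p))) (listsOfLength i) ∎
  where
  reassociate : ∀ a b c d → a ℕ.+ (b ℕ.+ (c ℕ.+ (d ℕ.+ 0))) ≡ a ℕ.+ b ℕ.+ c ℕ.+ d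
  reassociate = ℕ-Solver.solve-∀

sumOver-listsOfLength-firstStep : ∀ (f : List Step → ℕ) i →
  sumOver f (listsOfLength (suc i)) ≡ sumSteps (λ s → sumOver (f ∘ (s ∷_)) (listsOfLength i))
sumOver-listsOfLength-firstStep f i =
  trans (sumOver-listsOfLength-suc f i) (sumOver-sumSteps (λ s p → f (s ∷ p)) (listsOfLength i))

sumOver-listsOfLength-cong : ∀ L {f g : List Step → ℕ} → (∀ p → length p ≡ L → f p ≡ g p) →
  sumOver f (listsOfLength L) ≡ sumOver g (listsOfLength L)
sumOver-listsOfLength-cong zero    f≡g = cong (ℕ._+ 0) (f≡g [] refl)
sumOver-listsOfLength-cong (suc L) {f} {g} f≡g = begin
  sumOver f (listsOfLength (suc L))                          ≡⟨ sumOver-listsOfLength-firstStep f L ⟩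
  sumSteps (λ s → sumOver (f ∘ (s ∷_)) (listsOfLength L))    ≡⟨ cong₂ ℕ._+_ (cong₂ ℕ._+_ (cong₂ ℕ._+_ (tail U) (tail D)) (tail h)) (tail H) ⟩
  sumSteps (λ s → sumOver (g ∘ (s ∷_)) (listsOfLength L))    ≡⟨ sumOver-listsOfLength-firstStep g L ⟨
  sumOver g (listsOfLength (suc L))                          ∎
  where
  tail : ∀ s → sumOver (f ∘ (s ∷_)) (listsOfLength L) ≡ sumOver (g ∘ (s ∷_)) (listsOfLength L)
  tail s = sumOver-listsOfLength-cong L (λ p |p| → f≡g (s ∷ p) (cong suc |p|))

sumOver-listsOfLength-+ : ∀ i j (f : List Step → ℕ) →
  sumOver f (listsOfLength (i ℕ.+ j)) ≡ sumOver (λ p → sumOver (f ∘ (p ++_)) (listsOfLength j)) (listsOfLength i)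
sumOver-listsOfLength-+ zero    j f = sym (ℕ.+-identityʳ _)
sumOver-listsOfLength-+ (suc i) j f = begin
  sumOver f (listsOfLength (suc (i ℕ.+ j)))
    ≡⟨ sumOver-listsOfLength-firstStep f (i ℕ.+ j) ⟩
  sumSteps (λ s → sumOver (f ∘ (s ∷_)) (listsOfLength (i ℕ.+ j)))
    ≡⟨ cong₂ ℕ._+_ (cong₂ ℕ._+_ (cong₂ ℕ._+_ (split U) (split D)) (split h)) (split H) ⟩
  sumSteps (λ s → sumOver (λ p → sumOver (f ∘ ((s ∷ p) ++_)) (listsOfLength j)) (listsOfLength i))
    ≡⟨ sumOver-listsOfLength-firstStep (λ p → sumOver (f ∘ (p ++_)) (listsOfLength j)) i ⟨
  sumOver (λ p → sumOver (f ∘ (p ++_)) (listsOfLength j)) (listsOfLength (suc i)) ∎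
  where
  split : ∀ s → sumOver (f ∘ (s ∷_)) (listsOfLength (i ℕ.+ j))
              ≡ sumOver (λ p → sumOver (f ∘ ((s ∷ p) ++_)) (listsOfLength j)) (listsOfLength i)
  split s = sumOver-listsOfLength-+ i j (f ∘ (s ∷_))

count-pathEq : ∀ L q → length q ≡ L → sumOver (λ p → indicator (pathEq p q)) (listsOfLength L) ≡ 1
count-pathEq zero    []      _   = refl
count-pathEq (suc L) (t ∷ q) |q| = begin
  sumOver (λ p → indicator (pathEq p (t ∷ q))) (listsOfLength (suc L))
    ≡⟨ sumOver-listsOfLength-suc _ L ⟩
  sumOver (λ p → sumSteps (λ s → indicator (stepEq s t ∧ pathEq p q))) (listsOfLength L)
    ≡⟨ sumOver-cong (λ p → sumSteps-stepEq t (pathEq p q)) (listsOfLength L) ⟩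
  sumOver (λ p → indicator (pathEq p q)) (listsOfLength L)
    ≡⟨ count-pathEq L q (ℕ.suc-injective |q|) ⟩
  1 ∎

sumOver-listsUpTo : ∀ (f : List Step → ℕ) N → sumOver f (listsUpTo N) ≡ ΣN N (λ L → sumOver f (listsOfLength L))
sumOver-listsUpTo f N = trans (sumOver-concatMap f listsOfLength (upTo (suc N))) (sumOver-applyUpTo _ (λ L → L) N)

count-symmetricExcursions : ∀ ok → (∀ s → ok (mirrorStep s) ≡ ok s) → ∀ n →
  countB (λ q → isExcursion ok n q ∧ isSymmetric n q) (listsUpTo (n ℕ.+ n)) ≡ countB (isMeander ok 0 n) (listsUpTo n)
count-symmetricExcursions ok ok-mirror n = begin
  countB P (listsUpTo (n ℕ.+ n))                                ≡⟨ countB-sumOver P (listsUpTo (n ℕ.+ n)) ⟩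
  sumOver (indicator ∘ P) (listsUpTo (n ℕ.+ n))                 ≡⟨ sumOver-listsUpTo _ (n ℕ.+ n) ⟩
  ΣN (n ℕ.+ n) (λ L → sumOver (indicator ∘ P) (listsOfLength L)) ≡⟨ ΣN-double n _ odd-length ⟩
  ΣN n (λ i → sumOver (indicator ∘ P) (listsOfLength (i ℕ.+ i))) ≡⟨ ΣN-cong n (λ i _ → even-length i) ⟩
  ΣN n (λ i → sumOver (indicator ∘ M) (listsOfLength i))        ≡⟨ sumOver-listsUpTo _ n ⟨
  sumOver (indicator ∘ M) (listsUpTo n)                         ≡⟨ countB-sumOver M (listsUpTo n) ⟨
  countB M (listsUpTo n)                                        ∎
  where
  P M : List Step → Bool
  P q = isExcursion ok n q ∧ isSymmetric n q
  M = isMeander ok 0 n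
  odd-length : ∀ i → sumOver (indicator ∘ P) (listsOfLength (suc (i ℕ.+ i))) ≡ 0
  odd-length i = trans (sumOver-listsOfLength-cong (suc (i ℕ.+ i))
                         (λ q odd → cong indicator (trans (cong (isExcursion ok n q ∧_) (isSymmetric-odd n q i odd)) (∧-zeroʳ _))))
                       (sumOver-zero (listsOfLength (suc (i ℕ.+ i))))
  mirror-unique : ∀ i p → length p ≡ i → sumOver (λ q → indicator (P (p ++ q))) (listsOfLength i) ≡ indicator (M p)
  mirror-unique i p |p| = begin
    sumOver (λ q → indicator (P (p ++ q))) (listsOfLength i)
      ≡⟨ sumOver-listsOfLength-cong i (λ q |q| → trans (cong indicator (symmetric-halves ok ok-mirror n p q (trans |p| (sym |q|))))
                                                      (indicator-∧ (M p) (pathEq q (mirror p)))) ⟩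
    sumOver (λ q → indicator (M p) ℕ.* indicator (pathEq q (mirror p))) (listsOfLength i)
      ≡⟨ sumOver-*ˡ (indicator (M p)) _ (listsOfLength i) ⟩
    indicator (M p) ℕ.* sumOver (λ q → indicator (pathEq q (mirror p))) (listsOfLength i)
      ≡⟨ cong (indicator (M p) ℕ.*_) (count-pathEq i (mirror p) (trans (length-mirror p) |p|)) ⟩
    indicator (M p) ℕ.* 1
      ≡⟨ ℕ.*-identityʳ (indicator (M p)) ⟩
    indicator (M p) ∎
  even-length : ∀ i → sumOver (indicator ∘ P) (listsOfLength (i ℕ.+ i)) ≡ sumOver (indicator ∘ M) (listsOfLength i)
  even-length i = trans (sumOver-listsOfLength-+ i i (indicator ∘ P)) (sumOver-listsOfLength-cong i (mirror-unique i))

meanders : (Step → Bool) → ℕ → ℕ → ℕ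
meanders ok n ht = countB (isMeander ok ht n) (listsUpTo n)

countByLength : (List Step → Bool) → ℕ → ℕ
countByLength P n = ΣN n (λ i → sumOver (indicator ∘ P) (listsOfLength i))

meanders-byLength : ∀ ok n ht → meanders ok n ht ≡ countByLength (isMeander ok ht n) n
meanders-byLength ok n ht = trans (countB-sumOver _ (listsUpTo n)) (sumOver-listsUpTo _ n)

countByLength-∧ˡ : ∀ n b {P Q : List Step → Bool} → (∀ p → P p ≡ b ∧ Q p) → countByLength P n ≡ indicator b ℕ.* countByLength Q n
countByLength-∧ˡ n b {P} {Q} P≡b∧Q = begin
  ΣN n (λ i → sumOver (indicator ∘ P) (listsOfLength i))
    ≡⟨ ΣN-cong n (λ i _ → sumOver-cong (λ p → trans (cong indicator (P≡b∧Q p)) (indicator-∧ b (Q p))) (listsOfLength i)) ⟩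
  ΣN n (λ i → sumOver (λ p → indicator b ℕ.* indicator (Q p)) (listsOfLength i))
    ≡⟨ ΣN-cong n (λ i _ → sumOver-*ˡ (indicator b) _ (listsOfLength i)) ⟩
  ΣN n (λ i → indicator b ℕ.* sumOver (indicator ∘ Q) (listsOfLength i))
    ≡⟨ ΣN-*ˡ n (indicator b) _ ⟩
  indicator b ℕ.* countByLength Q n ∎

countByLength-false : ∀ n {P : List Step → Bool} → (∀ p → P p ≡ false) → countByLength P n ≡ 0
countByLength-false n P≡false = begin
  countByLength _ n                                        ≡⟨ ΣN-cong n (λ i _ → sumOver-cong (cong indicator ∘ P≡false) (listsOfLength i)) ⟩
  ΣN n (λ i → sumOver (λ _ → 0) (listsOfLength i))         ≡⟨ ΣN-cong n (λ i _ → sumOver-zero (listsOfLength i)) ⟩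
  ΣN n (λ _ → 0)                                           ≡⟨ ΣN-zero n ⟩
  0                                                        ∎

isMeander-long : ∀ ok ht n p → n < length p → isMeander ok ht n p ≡ false
isMeander-long ok ht n p n<|p| =
  trans (cong (λ b → allB ok p ∧ b ∧ staysNonNeg ht p) (dec-false (pathWidth p ℕ.≟ n) width≢n)) (∧-zeroʳ (allB ok p))
  where
  width≢n : pathWidth p ≢ n
  width≢n w≡n = ℕ.<⇒≱ n<|p| (subst (length p ≤_) w≡n (length≤pathWidth p))

meandersStartingWith : (Step → Bool) → Step → ℕ → ℕ → ℕ
meandersStartingWith ok s n ht = countByLength (isMeander ok ht (suc n) ∘ (s ∷_)) n

meanders-suc-bySteps : ∀ ok n ht → meanders ok (suc n) ht ≡ sumSteps (λ s → meandersStartingWith ok s n ht)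
meanders-suc-bySteps ok n ht = begin
  meanders ok (suc n) ht
    ≡⟨ meanders-byLength ok (suc n) ht ⟩
  ΣN (suc n) (λ i → sumOver (indicator ∘ M) (listsOfLength i))
    ≡⟨ ΣN-unfoldˡ n _ ⟩
  ΣN n (λ i → sumOver (indicator ∘ M) (listsOfLength (suc i)))
    ≡⟨ ΣN-cong n (λ i _ → sumOver-listsOfLength-firstStep _ i) ⟩
  ΣN n (λ i → sumSteps (λ s → sumOver (indicator ∘ M ∘ (s ∷_)) (listsOfLength i)))
    ≡⟨ ΣN-sumSteps n (λ s i → sumOver (indicator ∘ M ∘ (s ∷_)) (listsOfLength i)) ⟩
  sumSteps (λ s → meandersStartingWith ok s n ht) ∎
  where
  M = isMeander ok ht (suc n)

meandersStartingWith-U : ∀ ok n ht → meandersStartingWith ok U n ht ≡ indicator (ok U) ℕ.* meanders ok n (suc ht)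
meandersStartingWith-U ok n ht = trans (countByLength-∧ˡ n (ok U) (λ p → ∧-assoc (ok U) (allB ok p) _))
                                       (cong (indicator (ok U) ℕ.*_) (sym (meanders-byLength ok n (suc ht))))

meandersStartingWith-D : ∀ ok n ht → meandersStartingWith ok D n ht ≡ indicator (ok D) ℕ.* atPred (meanders ok n) ht
meandersStartingWith-D ok n zero     =
  trans (countByLength-false n (λ p → trans (cong ((ok D ∧ allB ok p) ∧_) (∧-zeroʳ _)) (∧-zeroʳ _)))
        (sym (ℕ.*-zeroʳ (indicator (ok D))))
meandersStartingWith-D ok n (suc ht) = trans (countByLength-∧ˡ n (ok D) (λ p → ∧-assoc (ok D) (allB ok p) _))
                                             (cong (indicator (ok D) ℕ.*_) (sym (meanders-byLength ok n ht)))

meandersStartingWith-h : ∀ ok n ht → meandersStartingWith ok h n ht ≡ indicator (ok h) ℕ.* meanders ok n ht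
meandersStartingWith-h ok n ht = trans (countByLength-∧ˡ n (ok h) (λ p → ∧-assoc (ok h) (allB ok p) _))
                                       (cong (indicator (ok h) ℕ.*_) (sym (meanders-byLength ok n ht)))

meandersStartingWith-H : ∀ ok n ht → meandersStartingWith ok H n ht ≡ indicator (ok H) ℕ.* atPred (λ m → meanders ok m ht) n
meandersStartingWith-H ok zero    ht = trans (countByLength-false 0 (λ p → ∧-zeroʳ (ok H ∧ allB ok p)))
                                             (sym (ℕ.*-zeroʳ (indicator (ok H))))
meandersStartingWith-H ok (suc n) ht = begin
  countByLength (isMeander ok ht (suc (suc n)) ∘ (H ∷_)) (suc n)
    ≡⟨ countByLength-∧ˡ (suc n) (ok H) (λ p → ∧-assoc (ok H) (allB ok p) _) ⟩
  indicator (ok H) ℕ.* (countByLength M n ℕ.+ sumOver (indicator ∘ M) (listsOfLength (suc n)))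
    ≡⟨ cong (λ t → indicator (ok H) ℕ.* (countByLength M n ℕ.+ t)) too-long ⟩
  indicator (ok H) ℕ.* (countByLength M n ℕ.+ 0)
    ≡⟨ cong (indicator (ok H) ℕ.*_) (trans (ℕ.+-identityʳ _) (sym (meanders-byLength ok n ht))) ⟩
  indicator (ok H) ℕ.* meanders ok n ht ∎
  where
  M = isMeander ok ht n
  too-long : sumOver (indicator ∘ M) (listsOfLength (suc n)) ≡ 0
  too-long = trans (sumOver-listsOfLength-cong (suc n)
                      (λ p |p| → cong indicator (isMeander-long ok ht n p (ℕ.≤-reflexive (sym |p|)))))
                   (sumOver-zero (listsOfLength (suc n)))

meanders-suc : ∀ ok n ht → meanders ok (suc n) ht ≡
      indicator (ok U) ℕ.* meanders ok n (suc ht)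
  ℕ.+ indicator (ok D) ℕ.* atPred (meanders ok n) ht
  ℕ.+ indicator (ok h) ℕ.* meanders ok n ht
  ℕ.+ indicator (ok H) ℕ.* atPred (λ m → meanders ok m ht) n
meanders-suc ok n ht = trans (meanders-suc-bySteps ok n ht)
  (cong₂ ℕ._+_ (cong₂ ℕ._+_ (cong₂ ℕ._+_ (meandersStartingWith-U ok n ht) (meandersStartingWith-D ok n ht))
                                        (meandersStartingWith-h ok n ht))
               (meandersStartingWith-H ok n ht))

meanders-motzkin-suc : ∀ n ht → meanders motzkinStep (suc n) ht
  ≡ meanders motzkinStep n (suc ht) ℕ.+ atPred (meanders motzkinStep n) ht ℕ.+ meanders motzkinStep n ht
meanders-motzkin-suc n ht = trans (meanders-suc motzkinStep n ht)
  (simplify (meanders motzkinStep n (suc ht)) (atPred (meanders motzkinStep n) ht) (meanders motzkinStep n ht))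
  where
  simplify : ∀ a b c → a ℕ.+ 0 ℕ.+ (b ℕ.+ 0) ℕ.+ (c ℕ.+ 0) ℕ.+ 0 ≡ a ℕ.+ b ℕ.+ c
  simplify = ℕ-Solver.solve-∀

meanders-schröder-suc : ∀ n ht → meanders schroderStep (suc n) ht
  ≡ meanders schroderStep n (suc ht) ℕ.+ atPred (meanders schroderStep n) ht ℕ.+ atPred (λ m → meanders schroderStep m ht) n
meanders-schröder-suc n ht = trans (meanders-suc schroderStep n ht)
  (simplify (meanders schroderStep n (suc ht)) (atPred (meanders schroderStep n) ht)
            (atPred (λ m → meanders schroderStep m ht) n))
  where
  simplify : ∀ a b d → a ℕ.+ 0 ℕ.+ (b ℕ.+ 0) ℕ.+ 0 ℕ.+ (d ℕ.+ 0) ≡ a ℕ.+ b ℕ.+ d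
  simplify = ℕ-Solver.solve-∀

adjacency : Profile → Profile
adjacency f zero    = f 1
adjacency f (suc x) = f (suc (suc x)) + f x

adjacency-cong : ∀ {f g} → f ≗ g → adjacency f ≗ adjacency g
adjacency-cong f≗g zero    = f≗g 1
adjacency-cong f≗g (suc x) = cong₂ _+_ (f≗g (suc (suc x))) (f≗g x)

adjacency-linear : ∀ n (a : ℕ → ℤ) (f : ℕ → Profile) →
  adjacency (λ y → ΣZ n (λ k → a k * f k y)) ≗ λ x → ΣZ n (λ k → a k * adjacency (f k) x)
adjacency-linear n a f zero    = refl
adjacency-linear n a f (suc x) = begin
  ΣZ n (λ k → a k * f k (suc (suc x))) + ΣZ n (λ k → a k * f k x)   ≡⟨ ΣZ-+ n _ _ ⟨
  ΣZ n (λ k → a k * f k (suc (suc x)) + a k * f k x)                ≡⟨ ΣZ-cong n (λ k _ → sym (ℤ.*-distribˡ-+ (a k) _ _)) ⟩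
  ΣZ n (λ k → a k * (f k (suc (suc x)) + f k x))                    ∎

pos-adjacency : ∀ (f : ℕ → ℕ) x → + (f (suc x) ℕ.+ atPred f x) ≡ adjacency (+_ ∘ f) x
pos-adjacency f zero    = cong +_ (ℕ.+-identityʳ (f 1))
pos-adjacency f (suc x) = ℤ.pos-+ (f (suc (suc x))) (f x)

pos-meanders-motzkin-suc : ∀ k x →
  + meanders motzkinStep (suc k) x ≡ adjacency (λ y → + meanders motzkinStep k y) x + + meanders motzkinStep k x
pos-meanders-motzkin-suc k x = begin
  + meanders motzkinStep (suc k) x
    ≡⟨ cong +_ (meanders-motzkin-suc k x) ⟩
  + (meanders motzkinStep k (suc x) ℕ.+ atPred (meanders motzkinStep k) x ℕ.+ meanders motzkinStep k x)
    ≡⟨ ℤ.pos-+ (meanders motzkinStep k (suc x) ℕ.+ atPred (meanders motzkinStep k) x) (meanders motzkinStep k x) ⟩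
  + (meanders motzkinStep k (suc x) ℕ.+ atPred (meanders motzkinStep k) x) + + meanders motzkinStep k x
    ≡⟨ cong (_+ + meanders motzkinStep k x) (pos-adjacency (meanders motzkinStep k) x) ⟩
  adjacency (λ y → + meanders motzkinStep k y) x + + meanders motzkinStep k x ∎
pos-meanders-schröder-one : ∀ x → + meanders schroderStep 1 x ≡ adjacency (λ y → + meanders motzkinStep 0 y) x
pos-meanders-schröder-one zero    = cong +_ (meanders-schröder-suc 0 0)
pos-meanders-schröder-one (suc x) = cong +_ (meanders-schröder-suc 0 (suc x))
pos-meanders-schröder-suc-suc : ∀ n x → + meanders schroderStep (suc (suc n)) x
                            ≡ adjacency (λ y → + meanders schroderStep (suc n) y) x + + meanders schroderStep n x
pos-meanders-schröder-suc-suc n x = begin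
  + meanders schroderStep (suc (suc n)) x
    ≡⟨ cong +_ (meanders-schröder-suc (suc n) x) ⟩
  + (meanders schroderStep (suc n) (suc x) ℕ.+ atPred (meanders schroderStep (suc n)) x ℕ.+ meanders schroderStep n x)
    ≡⟨ ℤ.pos-+ (meanders schroderStep (suc n) (suc x) ℕ.+ atPred (meanders schroderStep (suc n)) x)
               (meanders schroderStep n x) ⟩
  + (meanders schroderStep (suc n) (suc x) ℕ.+ atPred (meanders schroderStep (suc n)) x) + + meanders schroderStep n x
    ≡⟨ cong (_+ + meanders schroderStep n x) (pos-adjacency (meanders schroderStep (suc n)) x) ⟩
  adjacency (λ y → + meanders schroderStep (suc n) y) x + + meanders schroderStep n x ∎

module MeanderExpansion = FibonacciExpansion adjacency adjacency-cong adjacency-linear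
  (λ k x → + meanders motzkinStep k x) (λ n x → + meanders schroderStep n x)
  pos-meanders-motzkin-suc (λ _ → refl) pos-meanders-schröder-one pos-meanders-schröder-suc-suc

m≡meanders : ∀ n → m n ≡ meanders motzkinStep n 0
m≡meanders = count-symmetricExcursions motzkinStep (mirror-invariant motzkinStep refl)

s≡meanders : ∀ n → s n ≡ meanders schroderStep n 0
s≡meanders = count-symmetricExcursions schroderStep (mirror-invariant schroderStep refl)

theorem3p5 : ((n : ℕ) → + s n ≡ ΣZ n (λ k → sign (n ∸ k) * (+ snk n k) * (+ m k)))
    × ((k : ℕ) → (i : ℕ) → (snkGF k ⊛ (oneMinusXMinusX² ^S (ℕ.suc k))) i ≡ xPow k i)
theorem3p5 = s-expansion , snkGF-⊛-power
  where
  s-expansion : (n : ℕ) → + s n ≡ ΣZ n (λ k → sign (n ∸ k) * (+ snk n k) * (+ m k))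
  s-expansion n = begin
    + s n                                                     ≡⟨ cong +_ (s≡meanders n) ⟩
    + meanders schroderStep n 0                               ≡⟨ MeanderExpansion.expansion n 0 ⟩
    ΣZ n (λ k → signedSnk n k * + meanders motzkinStep k 0)   ≡⟨ ΣZ-cong n (λ k _ → cong (λ v → signedSnk n k * + v) (sym (m≡meanders k))) ⟩
    ΣZ n (λ k → signedSnk n k * + m k)                        ∎
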